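{- For every graph $G$, $\frac{\xi(G)(\xi(G)+1)}2\le e(G)+1$.
   Context: $e(G)$ is the number of edges of $G$. For a real symmetric matrix $A$, $\mathcal{G}(A)$ is the graph with $i\sim j$ ($i\ne j$) iff $a_{ij}\ne0$ (diagonal ignored). A real symmetric $A$ satisfies the Strong Arnold Hypothesis if there is no nonzero real symmetric $X$ with $AX=0$, $A\circ X=0$, $I\circ X=0$ ($\circ$ entrywise product). $\xi(G)$ is the maximum nullity among real symmetric matrices $A$ with $\mathcal{G}(A)=G$ satisfying the Strong Arnold Hypothesis. -}

module Defs where

open import Level using (Level; _⊔_) renaming (suc to lsuc; zero to lzero)
open import Data.Nat as ℕ using (ℕ; zero; suc)
open import Data.Bool using (Bool; true; false)
open import Data.Fin using (Fin; toℕ)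
open import Data.Product using (Σ; ∃; _×_; _,_)
open import Data.List using (List; length; filter; allFin; cartesianProduct)
open import Relation.Nullary using (¬_)
open import Relation.Binary.PropositionalEquality using (_≡_; _≢_)
open import Relation.Binary using (Rel)
open import Relation.Binary.Structures using (IsTotalOrder)
open import Algebra.Structures using (IsCommutativeRing)
open import Data.Fin.Properties using (_≟_)
open import Relation.Nullary.Decidable using (does)
import Data.Nat.Properties as ℕP

record RealField : Set₁ where
  infixl 6 _+_
  infixl 7 _*_
  infix  4 _≤_
  field
    ℝ     : Set
    _+_   : ℝ → ℝ → ℝ
    _*_   : ℝ → ℝ → ℝ
    -_    : ℝ → ℝ
    0ℝ    : ℝ
    1ℝ    : ℝ
    _≤_   : Rel ℝ lzero
    isCommutativeRing : IsCommutativeRing _≡_ _+_ _*_ -_ 0ℝ 1ℝ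
    0≢1   : 0ℝ ≢ 1ℝ
    inverse : ∀ x → x ≢ 0ℝ → Σ ℝ λ y → x * y ≡ 1ℝ
    isTotalOrder : IsTotalOrder _≡_ _≤_
    +-mono-≤ : ∀ {x y} z → x ≤ y → x + z ≤ y + z
    *-nonneg : ∀ {x y} → 0ℝ ≤ x → 0ℝ ≤ y → 0ℝ ≤ x * y
    sup : (P : ℝ → Set) → (∃ λ x → P x) → (∃ λ b → ∀ x → P x → x ≤ b) →
          ∃ λ s → (∀ x → P x → x ≤ s) × (∀ b → (∀ x → P x → x ≤ b) → s ≤ b)

record Graph (n : ℕ) : Set where
  field
    adj       : Fin n → Fin n → Bool
    adj-sym   : ∀ i j → adj i j ≡ adj j i
    adj-irrefl : ∀ i → adj i i ≡ false
open Graph public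

edgeList : ∀ {n} → Graph n → List (Fin n × Fin n)
edgeList {n} G =
  filter (λ { (i , j) → Data.Bool._∧_ (does (toℕ i ℕP.<? toℕ j)) (adj G i j) Data.Bool.≟ true })
         (cartesianProduct (allFin n) (allFin n))

e : ∀ {n} → Graph n → ℕ
e G = length (edgeList G)

module Matrices (R : RealField) where
  open RealField R

  Matrix : ℕ → ℕ → Set
  Matrix m n = Fin m → Fin n → ℝ

  Vector : ℕ → Set
  Vector n = Fin n → ℝ

  Σ[_] : ∀ n → (Fin n → ℝ) → ℝ
  Σ[ zero ] f = 0ℝ
  Σ[ suc n ] f = f Fin.zero + Σ[ n ] (λ i → f (Fin.suc i))

  _·_ : ∀ {m n p} → Matrix m n → Matrix n p → Matrix m p
  _·_ {n = n} A B i j = Σ[ n ] (λ k → A i k * B k j)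

  _∘ₑ_ : ∀ {m n} → Matrix m n → Matrix m n → Matrix m n
  (A ∘ₑ B) i j = A i j * B i j

  I : ∀ {n} → Matrix n n
  I i j with i ≟ j
  ... | Relation.Nullary.yes _ = 1ℝ
  ... | Relation.Nullary.no  _ = 0ℝ

  Zero : ∀ {m n} → Matrix m n
  Zero _ _ = 0ℝ

  Symmetric : ∀ {n} → Matrix n n → Set
  Symmetric A = ∀ i j → A i j ≡ A j i

  HasGraph : ∀ {n} → Matrix n n → Graph n → Set
  HasGraph A G = ∀ i j → i ≢ j → (adj G i j ≡ true → A i j ≢ 0ℝ) × (A i j ≢ 0ℝ → adj G i j ≡ true)

  SAH : ∀ {n} → Matrix n n → Set
  SAH A = ∀ X → Symmetric X → (A · X) ≡ₘ Zero → (A ∘ₑ X) ≡ₘ Zero → (I ∘ₑ X) ≡ₘ Zero → X ≡ₘ Zero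
    where
      _≡ₘ_ : ∀ {m n} → Matrix m n → Matrix m n → Set
      P ≡ₘ Q = ∀ i j → P i j ≡ Q i j

  _⊛_ : ∀ {m n} → Matrix m n → Vector n → Vector m
  _⊛_ {n = n} A v i = Σ[ n ] (λ k → A i k * v k)

  InKernel : ∀ {m n} → Matrix m n → Vector n → Set
  InKernel A v = ∀ i → (A ⊛ v) i ≡ 0ℝ

  lincomb : ∀ {k n} → (Fin k → ℝ) → (Fin k → Vector n) → Vector n
  lincomb {k} c v j = Σ[ k ] (λ i → c i * v i j)

  LinearlyIndependent : ∀ {k n} → (Fin k → Vector n) → Set
  LinearlyIndependent {k} v = ∀ c → (∀ j → lincomb c v j ≡ 0ℝ) → ∀ i → c i ≡ 0ℝ

  HasNullity : ∀ {m n} → Matrix m n → ℕ → Set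
  HasNullity {n = n} A k =
    Σ (Fin k → Vector n) λ v →
      (∀ i → InKernel A (v i)) × LinearlyIndependent v ×
      (∀ w → InKernel A w → Σ (Fin k → ℝ) λ c → ∀ j → lincomb c v j ≡ w j)

-- Let u₁, …, u_k be a basis of ker A. The k(k+1)/2 symmetric matrices u_p u_qᵀ + u_q u_pᵀ (p ≤ q) are
-- annihilated by A, so by the Strong Arnold Hypothesis their restrictions to the e(G) edge entries and the
-- n diagonal entries are independent vectors of ℝ^(e(G) + n). These restrictions are orthogonal to the
-- coordinate vectors of the functionals X ↦ (A X)_ll (or X ↦ X_ll when every u_p vanishes at l). If c
-- combines those functionals to zero then c_a = −c_b along edges, so diag(c²) commutes with A; if moreover
-- c vanishes at a vertex i₀ where some u_r is nonzero, a second application of the Strong Arnold Hypothesis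
-- shows that c² vanishes wherever some u_p does not. So the n − 1 functionals other than that of i₀ are
-- independent, and k(k+1)/2 + n − 1 ≤ e(G) + n. Equality with 0 is not decidable in a real field, so
-- independence is only established under double negation, which suffices for the decidable conclusion.

module Submission where

open import Defs

open import Algebra.Bundles using (CommutativeRing)
import Algebra.Properties.CommutativeSemigroup as CommutativeSemigroupProperties
import Algebra.Properties.Ring as RingProperties
import Algebra.Properties.Semiring.Mult as SemiringMultProperties
open import Algebra.Solver.Ring.AlmostCommutativeRing
  using (AlmostCommutativeRing; _-Raw-AlmostCommutative⟶_; fromCommutativeRing)
open import Data.Bool.Base using (Bool; true; false; _∧_; if_then_else_)
import Data.Bool.Properties as Bool
open import Data.Fin.Base using (Fin; zero; suc; toℕ; punchIn; _↑ˡ_; _↑ʳ_; splitAt)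
import Data.Fin.Properties as Fin
open import Data.Fin.Properties using (punchInᵢ≢i)
open import Data.Integer.Base as ℤ using (ℤ; -[1+_]; _⊖_; _◃_; ∣_∣)
import Data.Integer.Properties as ℤ
open import Data.List.Base as List using (List; []; _∷_; length; lookup; filter; cartesianProduct; allFin)
open import Data.List.Membership.Propositional using (_∈_)
open import Data.List.Membership.Propositional.Properties using (∈-filter⁺; ∈-cartesianProduct⁺; ∈-allFin)
import Data.List.Relation.Unary.Any as Any
import Data.List.Relation.Unary.Any.Properties as Any
open import Data.Maybe.Base using (Maybe; just; nothing)
open import Data.Nat.Base as ℕ using (ℕ; zero; suc)
open import Data.Nat.DivMod using (m*n/n≡m)
import Data.Nat.Properties as ℕ
open import Data.Nat.Tactic.RingSolver using () renaming (solve to ℕ-solve)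
open import Data.Product.Base as Product using (Σ; _×_; _,_; proj₁; proj₂; uncurry)
open import Data.Sign.Base as Sign using (Sign)
open import Data.Sum.Base using (_⊎_; inj₁; inj₂)
open import Data.Vec.Functional using (insertAt; removeAt; _++_)
open import Data.Vec.Functional.Properties using (lookup-++ˡ; lookup-++ʳ)
open import Effect.Monad using (RawMonad)
open import Function.Base using (_∘_; id)
open import Level using (0ℓ)
open import Relation.Binary.Definitions using (tri<; tri≈; tri>)
open import Relation.Binary.PropositionalEquality as ≡ using (_≡_; _≢_; cong)
open import Relation.Binary.Structures using (IsTotalOrder)
open import Relation.Nullary using (Dec; yes; no; does)
open import Relation.Nullary.Decidable using (¬¬-excluded-middle; dec-true; dec-false; decidable-stable)
open import Relation.Nullary.Negation using (¬_; contradiction; ¬¬-Monad)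

-- The ring solver needs coefficients with decidable equality; ℤ maps into every commutative ring.
module IntegerCoefficients {c ℓ} (CR : CommutativeRing c ℓ) where

  open CommutativeRing CR
  open RingProperties ring using (-0#≈0#; -‿involutive; -‿+-comm; -‿distribˡ-*)
  open SemiringMultProperties semiring using (×-homo-+; ×1-homo-*) renaming (_×_ to _×ᵤ_)
  open CommutativeSemigroupProperties +-commutativeSemigroup
    using () renaming (interchange to +-interchange)
  open CommutativeSemigroupProperties *-commutativeSemigroup
    using () renaming (interchange to *-interchange)
  open import Relation.Binary.Reasoning.Setoid setoid

  fromℕ : ℕ → Carrier
  fromℕ n = n ×ᵤ 1#

  fromℤ : ℤ → Carrier
  fromℤ (ℤ.+ n)  = fromℕ n
  fromℤ -[1+ n ] = - fromℕ (suc n)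

  fromSign : Sign → Carrier
  fromSign Sign.+ = 1#
  fromSign Sign.- = - 1#

  +-cancel-common : ∀ c x y → (c + x) + - (c + y) ≈ x + - y
  +-cancel-common c x y = begin
    (c + x) + - (c + y)     ≈⟨ +-congˡ (-‿+-comm c y) ⟨
    (c + x) + (- c + - y)   ≈⟨ +-interchange c x (- c) (- y) ⟩
    (c + - c) + (x + - y)   ≈⟨ +-congʳ (-‿inverseʳ c) ⟩
    0# + (x + - y)          ≈⟨ +-identityˡ _ ⟩
    x + - y                 ∎

  fromℤ-⊖ : ∀ m n → fromℤ (m ⊖ n) ≈ fromℕ m + - fromℕ n
  fromℤ-⊖ zero    zero    = sym (-‿inverseʳ 0#)
  fromℤ-⊖ zero    (suc n) = sym (+-identityˡ _)
  fromℤ-⊖ (suc m) zero    = sym (trans (+-congˡ -0#≈0#) (+-identityʳ _))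
  fromℤ-⊖ (suc m) (suc n) = begin
    fromℤ (suc m ⊖ suc n)              ≡⟨ cong fromℤ (ℤ.[1+m]⊖[1+n]≡m⊖n m n) ⟩
    fromℤ (m ⊖ n)                      ≈⟨ fromℤ-⊖ m n ⟩
    fromℕ m + - fromℕ n                ≈⟨ +-cancel-common 1# (fromℕ m) (fromℕ n) ⟨
    fromℕ (suc m) + - fromℕ (suc n)    ∎

  fromℤ-+ : ∀ i j → fromℤ (i ℤ.+ j) ≈ fromℤ i + fromℤ j
  fromℤ-+ (ℤ.+ m)  (ℤ.+ n)  = ×-homo-+ 1# m n
  fromℤ-+ (ℤ.+ m)  -[1+ n ] = fromℤ-⊖ m (suc n)
  fromℤ-+ -[1+ m ] (ℤ.+ n)  = trans (fromℤ-⊖ n (suc m)) (+-comm _ _)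
  fromℤ-+ -[1+ m ] -[1+ n ] = begin
    - fromℕ (suc (suc (m ℕ.+ n)))      ≡⟨ cong (λ k → - fromℕ (suc k)) (ℕ.+-suc m n) ⟨
    - fromℕ (suc m ℕ.+ suc n)          ≈⟨ -‿cong (×-homo-+ 1# (suc m) (suc n)) ⟩
    - (fromℕ (suc m) + fromℕ (suc n))  ≈⟨ -‿+-comm _ _ ⟨
    - fromℕ (suc m) + - fromℕ (suc n)  ∎

  fromℤ-neg : ∀ i → fromℤ (ℤ.- i) ≈ - fromℤ i
  fromℤ-neg (ℤ.+ zero)  = sym -0#≈0#
  fromℤ-neg (ℤ.+ suc n) = refl
  fromℤ-neg -[1+ n ]    = sym (-‿involutive _)

  -x≈-1*x : ∀ x → - x ≈ - 1# * x
  -x≈-1*x x = trans (-‿cong (sym (*-identityˡ x))) (-‿distribˡ-* 1# x)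

  fromSign-* : ∀ s t → fromSign (s Sign.* t) ≈ fromSign s * fromSign t
  fromSign-* Sign.+ t      = sym (*-identityˡ _)
  fromSign-* Sign.- Sign.+ = sym (*-identityʳ _)
  fromSign-* Sign.- Sign.- = trans (sym (-‿involutive 1#)) (-x≈-1*x (- 1#))

  fromℤ-◃ : ∀ s n → fromℤ (s ◃ n) ≈ fromSign s * fromℕ n
  fromℤ-◃ s      zero    = sym (zeroʳ _)
  fromℤ-◃ Sign.+ (suc n) = sym (*-identityˡ _)
  fromℤ-◃ Sign.- (suc n) = -x≈-1*x _

  fromℤ-sign-abs : ∀ i → fromℤ i ≈ fromSign (ℤ.sign i) * fromℕ ∣ i ∣
  fromℤ-sign-abs (ℤ.+ n)  = sym (*-identityˡ _)
  fromℤ-sign-abs -[1+ n ] = -x≈-1*x _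

  fromℤ-* : ∀ i j → fromℤ (i ℤ.* j) ≈ fromℤ i * fromℤ j
  fromℤ-* i j = begin
    fromℤ (ℤ.sign i Sign.* ℤ.sign j ◃ ∣ i ∣ ℕ.* ∣ j ∣)
      ≈⟨ fromℤ-◃ (ℤ.sign i Sign.* ℤ.sign j) (∣ i ∣ ℕ.* ∣ j ∣) ⟩
    fromSign (ℤ.sign i Sign.* ℤ.sign j) * fromℕ (∣ i ∣ ℕ.* ∣ j ∣)
      ≈⟨ *-cong (fromSign-* (ℤ.sign i) (ℤ.sign j)) (×1-homo-* ∣ i ∣ ∣ j ∣) ⟩
    (fromSign (ℤ.sign i) * fromSign (ℤ.sign j)) * (fromℕ ∣ i ∣ * fromℕ ∣ j ∣)
      ≈⟨ *-interchange _ _ _ _ ⟩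
    (fromSign (ℤ.sign i) * fromℕ ∣ i ∣) * (fromSign (ℤ.sign j) * fromℕ ∣ j ∣)
      ≈⟨ *-cong (fromℤ-sign-abs i) (fromℤ-sign-abs j) ⟨
    fromℤ i * fromℤ j ∎

  almostCommutativeRing : AlmostCommutativeRing c ℓ
  almostCommutativeRing = fromCommutativeRing CR

  fromℤ-morphism : ℤ.+-*-rawRing -Raw-AlmostCommutative⟶ almostCommutativeRing
  fromℤ-morphism = record
    { ⟦_⟧    = fromℤ
    ; +-homo = fromℤ-+
    ; *-homo = fromℤ-*
    ; -‿homo = fromℤ-neg
    ; 0-homo = refl
    ; 1-homo = +-identityʳ 1#
    }

  fromℤ-≟ : ∀ i j → Maybe (fromℤ i ≈ fromℤ j)
  fromℤ-≟ i j with i ℤ.≟ j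
  ... | yes ≡.refl = just refl
  ... | no _       = nothing

  open import Algebra.Solver.Ring ℤ.+-*-rawRing almostCommutativeRing fromℤ-morphism fromℤ-≟ public

open RawMonad (¬¬-Monad {0ℓ}) using (pure; _<$>_; _>>=_)

¬¬-∀ : ∀ {n} {P : Fin n → Set} → (∀ i → ¬ ¬ P i) → ¬ ¬ (∀ i → P i)
¬¬-∀ = Fin.sequence (RawMonad.rawApplicative ¬¬-Monad)

insertAt-self : ∀ {A : Set} {m} (xs : Fin m → A) i x → insertAt xs i x i ≡ x
insertAt-self             xs zero    x = ≡.refl
insertAt-self {m = suc m} xs (suc i) x = insertAt-self (xs ∘ suc) i x

insertAt-punchIn : ∀ {A : Set} {m} (xs : Fin m → A) i x j → insertAt xs i x (punchIn i j) ≡ xs j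
insertAt-punchIn xs zero    x j       = ≡.refl
insertAt-punchIn xs (suc i) x zero    = ≡.refl
insertAt-punchIn xs (suc i) x (suc j) = insertAt-punchIn (xs ∘ suc) i x j

↑-cases : ∀ {a b} {P : Fin (a ℕ.+ b) → Set} → (∀ s → P (s ↑ˡ b)) → (∀ t → P (a ↑ʳ t)) → ∀ i → P i
↑-cases {a} {b} {P} left right i with splitAt a i in eq
... | inj₁ s = ≡.subst P (Fin.splitAt⁻¹-↑ˡ eq) (left s)
... | inj₂ t = ≡.subst P (Fin.splitAt⁻¹-↑ʳ eq) (right t)

triangle : ℕ → ℕ
triangle zero    = 0
triangle (suc k) = suc k ℕ.+ triangle k

-- The pairs (p , q) with p ≤ q, each listed once.
upperPairs : ∀ k → Fin (triangle k) → Fin k × Fin k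
upperPairs zero    = λ ()
upperPairs (suc k) = (λ q → zero , q) ++ (Product.map suc suc ∘ upperPairs k)

module _ (RF : RealField) where

  open RealField RF renaming (_≤_ to _≤ℝ_)
  open Matrices RF

  ℝ-commutativeRing : CommutativeRing _ _
  ℝ-commutativeRing = record { isCommutativeRing = isCommutativeRing }

  open CommutativeRing ℝ-commutativeRing
    using ( +-identityˡ; +-identityʳ; +-comm; +-assoc; -‿inverseˡ; -‿inverseʳ
          ; *-identityˡ; *-identityʳ; *-comm; *-assoc; zeroˡ; zeroʳ
          ; distribˡ; distribʳ; ring )
  open RingProperties ring using (-0#≈0#; -‿involutive; -‿+-comm; -‿distribˡ-*; -‿distribʳ-*; +-inverseʳ-unique)
  open CommutativeSemigroupProperties (CommutativeRing.+-commutativeSemigroup ℝ-commutativeRing)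
    using () renaming (interchange to +-interchange; x∙yz≈y∙xz to x+yz≈y+xz)
  open CommutativeSemigroupProperties (CommutativeRing.*-commutativeSemigroup ℝ-commutativeRing)
    using () renaming (x∙yz≈y∙xz to x*yz≈y*xz)
  open IntegerCoefficients ℝ-commutativeRing using (solve; _:=_; _:+_; _:*_; :-_; con)
  open ≡ using (refl; sym; trans; cong₂; subst; module ≡-Reasoning)
  open ≡-Reasoning

  Σ-cong : ∀ {m} {f g : Fin m → ℝ} → (∀ i → f i ≡ g i) → Σ[ m ] f ≡ Σ[ m ] g
  Σ-cong {zero}  f≗g = refl
  Σ-cong {suc m} f≗g = cong₂ _+_ (f≗g zero) (Σ-cong (f≗g ∘ suc))

  Σ-zero : ∀ {m} {f : Fin m → ℝ} → (∀ i → f i ≡ 0ℝ) → Σ[ m ] f ≡ 0ℝ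
  Σ-zero {zero}  f≗0 = refl
  Σ-zero {suc m} f≗0 = trans (cong₂ _+_ (f≗0 zero) (Σ-zero (f≗0 ∘ suc))) (+-identityʳ 0ℝ)

  Σ-distrib-+ : ∀ m (f g : Fin m → ℝ) → Σ[ m ] (λ i → f i + g i) ≡ Σ[ m ] f + Σ[ m ] g
  Σ-distrib-+ zero    f g = sym (+-identityʳ 0ℝ)
  Σ-distrib-+ (suc m) f g = trans (cong ((f zero + g zero) +_) (Σ-distrib-+ m (f ∘ suc) (g ∘ suc)))
                                  (+-interchange _ _ _ _)

  Σ-distrib-neg : ∀ m (f : Fin m → ℝ) → Σ[ m ] (λ i → - f i) ≡ - Σ[ m ] f
  Σ-distrib-neg zero    f = sym -0#≈0#
  Σ-distrib-neg (suc m) f = trans (cong (- f zero +_) (Σ-distrib-neg m (f ∘ suc))) (-‿+-comm _ _)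

  *-distribˡ-Σ : ∀ m a (f : Fin m → ℝ) → a * Σ[ m ] f ≡ Σ[ m ] (λ i → a * f i)
  *-distribˡ-Σ zero    a f = zeroʳ a
  *-distribˡ-Σ (suc m) a f = trans (distribˡ a _ _) (cong (a * f zero +_) (*-distribˡ-Σ m a (f ∘ suc)))

  *-distribʳ-Σ : ∀ m a (f : Fin m → ℝ) → Σ[ m ] f * a ≡ Σ[ m ] (λ i → f i * a)
  *-distribʳ-Σ m a f = trans (*-comm _ a) (trans (*-distribˡ-Σ m a f) (Σ-cong (λ i → *-comm a (f i))))

  Σ-comm : ∀ m p (f : Fin m → Fin p → ℝ) → Σ[ m ] (λ i → Σ[ p ] (f i)) ≡ Σ[ p ] (λ j → Σ[ m ] (λ i → f i j))
  Σ-comm zero    p f = sym (Σ-zero {p} (λ _ → refl))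
  Σ-comm (suc m) p f = trans (cong (Σ[ p ] (f zero) +_) (Σ-comm m p (f ∘ suc)))
                             (sym (Σ-distrib-+ p (f zero) _))

  Σ-++ : ∀ a b (f : Fin (a ℕ.+ b) → ℝ) →
    Σ[ a ℕ.+ b ] f ≡ Σ[ a ] (λ i → f (i ↑ˡ b)) + Σ[ b ] (λ j → f (a ↑ʳ j))
  Σ-++ zero    b f = sym (+-identityˡ _)
  Σ-++ (suc a) b f = trans (cong (f zero +_) (Σ-++ a b (f ∘ suc))) (sym (+-assoc _ _ _))

  Σ-punchIn : ∀ m (p : Fin (suc m)) (f : Fin (suc m) → ℝ) → Σ[ suc m ] f ≡ f p + Σ[ m ] (f ∘ punchIn p)
  Σ-punchIn m       zero    f = refl
  Σ-punchIn (suc m) (suc p) f = trans (cong (f zero +_) (Σ-punchIn m p (f ∘ suc))) (x+yz≈y+xz _ _ _)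

  I-diag : ∀ {n} (i : Fin n) → I i i ≡ 1ℝ
  I-diag i with i Fin.≟ i
  ... | yes _  = refl
  ... | no i≢i = contradiction refl i≢i

  I-offDiag : ∀ {n} {i j : Fin n} → i ≢ j → I i j ≡ 0ℝ
  I-offDiag {i = i} {j} i≢j with i Fin.≟ j
  ... | yes i≡j = contradiction i≡j i≢j
  ... | no _    = refl

  I-sym : ∀ {n} (i j : Fin n) → I i j ≡ I j i
  I-sym i j with i Fin.≟ j | j Fin.≟ i
  ... | yes _   | yes _   = refl
  ... | no _    | no _    = refl
  ... | yes i≡j | no j≢i  = contradiction (sym i≡j) j≢i
  ... | no i≢j  | yes j≡i = contradiction (sym j≡i) i≢j

  I-suc : ∀ {n} (i j : Fin n) → I (suc i) (suc j) ≡ I i j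
  I-suc i j = by-cases (i Fin.≟ j)
    where
    by-cases : Dec (i ≡ j) → I (suc i) (suc j) ≡ I i j
    by-cases (yes ≡.refl) = trans (I-diag (suc i)) (sym (I-diag i))
    by-cases (no i≢j)     = trans (I-offDiag (i≢j ∘ Fin.suc-injective)) (sym (I-offDiag i≢j))

  Σ-I : ∀ {n} (l : Fin n) (h : Fin n → ℝ) → Σ[ n ] (λ i → I l i * h i) ≡ h l
  Σ-I {suc n} l h = begin
    Σ[ suc n ] (λ i → I l i * h i)                              ≡⟨ Σ-punchIn n l (λ i → I l i * h i) ⟩
    I l l * h l + Σ[ n ] (λ t → I l (punchIn l t) * h (punchIn l t))
      ≡⟨ cong₂ _+_ (trans (cong (_* h l) (I-diag l)) (*-identityˡ _)) (Σ-zero off-l) ⟩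
    h l + 0ℝ                                                    ≡⟨ +-identityʳ _ ⟩
    h l                                                         ∎
    where
    off-l : ∀ t → I l (punchIn l t) * h (punchIn l t) ≡ 0ℝ
    off-l t = trans (cong (_* h (punchIn l t)) (I-offDiag (punchInᵢ≢i l t ∘ sym))) (zeroˡ _)

  Σ-I′ : ∀ {n} (l : Fin n) (h : Fin n → ℝ) → Σ[ n ] (λ i → h i * I i l) ≡ h l
  Σ-I′ l h = trans (Σ-cong (λ i → trans (*-comm (h i) _) (cong (_* h i) (I-sym i l)))) (Σ-I l h)

  x*y≡0⇒x≡0 : ∀ {x y} → y ≢ 0ℝ → x * y ≡ 0ℝ → x ≡ 0ℝ
  x*y≡0⇒x≡0 {x} {y} y≢0 xy≡0 = begin
    x                ≡⟨ *-identityʳ x ⟨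
    x * 1ℝ           ≡⟨ cong (x *_) y*y⁻¹≡1 ⟨
    x * (y * y⁻¹)    ≡⟨ *-assoc x y y⁻¹ ⟨
    (x * y) * y⁻¹    ≡⟨ cong (_* y⁻¹) xy≡0 ⟩
    0ℝ * y⁻¹         ≡⟨ zeroˡ _ ⟩
    0ℝ               ∎
    where
    open Σ (inverse y y≢0) renaming (proj₁ to y⁻¹; proj₂ to y*y⁻¹≡1)

  *-≢0 : ∀ {x y} → x ≢ 0ℝ → y ≢ 0ℝ → x * y ≢ 0ℝ
  *-≢0 x≢0 y≢0 xy≡0 = x≢0 (x*y≡0⇒x≡0 y≢0 xy≡0)

  open IsTotalOrder isTotalOrder
    using (total; antisym; ≲-respˡ-≈; ≲-respʳ-≈) renaming (trans to ≤ℝ-trans; refl to ≤ℝ-refl)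

  x≤0⇒0≤-x : ∀ {x} → x ≤ℝ 0ℝ → 0ℝ ≤ℝ - x
  x≤0⇒0≤-x {x} x≤0 = ≲-respˡ-≈ (-‿inverseʳ x) (≲-respʳ-≈ (+-identityˡ _) (+-mono-≤ (- x) x≤0))

  0≤x*x : ∀ x → 0ℝ ≤ℝ x * x
  0≤x*x x with total 0ℝ x
  ... | inj₁ 0≤x = *-nonneg 0≤x 0≤x
  ... | inj₂ x≤0 = ≲-respʳ-≈ (solve 1 (λ x → :- x :* :- x := x :* x) refl x)
                               (*-nonneg (x≤0⇒0≤-x x≤0) (x≤0⇒0≤-x x≤0))

  0≤x+y : ∀ {x y} → 0ℝ ≤ℝ x → 0ℝ ≤ℝ y → 0ℝ ≤ℝ x + y
  0≤x+y {x} {y} 0≤x 0≤y = ≤ℝ-trans 0≤y (≲-respˡ-≈ (+-identityˡ y) (+-mono-≤ y 0≤x))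

  x+y≡0⇒x≡0 : ∀ {x y} → 0ℝ ≤ℝ x → 0ℝ ≤ℝ y → x + y ≡ 0ℝ → x ≡ 0ℝ
  x+y≡0⇒x≡0 {x} {y} 0≤x 0≤y x+y≡0 =
    antisym (≲-respˡ-≈ (+-identityˡ x) (≲-respʳ-≈ (trans (+-comm y x) x+y≡0) (+-mono-≤ x 0≤y))) 0≤x

  1+1≢0 : 1ℝ + 1ℝ ≢ 0ℝ
  1+1≢0 2≡0 = 0≢1 (sym (x+y≡0⇒x≡0 0≤1 0≤1 2≡0))
    where
    0≤1 : 0ℝ ≤ℝ 1ℝ
    0≤1 = ≲-respʳ-≈ (*-identityˡ 1ℝ) (0≤x*x 1ℝ)

  ⟨_,_⟩ : ∀ {d} → Vector d → Vector d → ℝ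
  ⟨_,_⟩ {d} x y = Σ[ d ] (λ j → x j * y j)

  0≤⟨x,x⟩ : ∀ {d} (x : Vector d) → 0ℝ ≤ℝ ⟨ x , x ⟩
  0≤⟨x,x⟩ {zero}  x = ≤ℝ-refl
  0≤⟨x,x⟩ {suc d} x = 0≤x+y (0≤x*x (x zero)) (0≤⟨x,x⟩ (x ∘ suc))

  ⟨x,x⟩≡0⇒x≡0 : ∀ {d} (x : Vector d) → ⟨ x , x ⟩ ≡ 0ℝ → ∀ j → ¬ ¬ x j ≡ 0ℝ
  ⟨x,x⟩≡0⇒x≡0 {suc d} x xx≡0 zero x₀≢0 =
    *-≢0 x₀≢0 x₀≢0 (x+y≡0⇒x≡0 (0≤x*x (x zero)) (0≤⟨x,x⟩ (x ∘ suc)) xx≡0)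
  ⟨x,x⟩≡0⇒x≡0 {suc d} x xx≡0 (suc j) = ⟨x,x⟩≡0⇒x≡0 (x ∘ suc)
    (x+y≡0⇒x≡0 (0≤⟨x,x⟩ (x ∘ suc)) (0≤x*x (x zero)) (trans (+-comm _ _) xx≡0)) j

  -- Independence and dimension in ℝ^d

  WeaklyIndependent : ∀ {m d} → (Fin m → Vector d) → Set
  WeaklyIndependent v = ∀ c → (∀ j → lincomb c v j ≡ 0ℝ) → ∀ i → ¬ ¬ c i ≡ 0ℝ

  lincomb-insertAt : ∀ {m d} (v : Fin (suc m) → Vector d) (c : Fin m → ℝ) p γ j →
    lincomb (insertAt c p γ) v j ≡ γ * v p j + Σ[ m ] (λ t → c t * v (punchIn p t) j)
  lincomb-insertAt {m} v c p γ j = trans (Σ-punchIn m p (λ i → insertAt c p γ i * v i j))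
    (cong₂ _+_ (cong (_* v p j) (insertAt-self c p γ))
               (Σ-cong (λ t → cong (_* v (punchIn p t) j) (insertAt-punchIn c p γ t))))

  weaklyIndependent-tail : ∀ {m d} (v : Fin m → Vector (suc d)) → (∀ p → v p zero ≡ 0ℝ) →
    WeaklyIndependent v → WeaklyIndependent (λ p → v p ∘ suc)
  weaklyIndependent-tail v v₀≡0 v-ind c c·tail≡0 = v-ind c λ
    { zero    → Σ-zero (λ p → trans (cong (c p *_) (v₀≡0 p)) (zeroʳ _))
    ; (suc j) → c·tail≡0 j }

  -- Gaussian elimination of the first coordinate, with pivot row p.
  weaklyIndependent-pivot : ∀ {m d} (v : Fin (suc m) → Vector (suc d)) → WeaklyIndependent v →
    ∀ p → v p zero ≢ 0ℝ → Σ (Fin m → Vector d) WeaklyIndependent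
  weaklyIndependent-pivot {m} v v-ind p pivot≢0 = w , w-ind
    where
    open Σ (inverse (v p zero) pivot≢0) renaming (proj₁ to pivot⁻¹; proj₂ to pivot*pivot⁻¹≡1)

    λ′ : Fin m → ℝ
    λ′ t = v (punchIn p t) zero * pivot⁻¹

    λ′*pivot : ∀ t → λ′ t * v p zero ≡ v (punchIn p t) zero
    λ′*pivot t = begin
      (v (punchIn p t) zero * pivot⁻¹) * v p zero  ≡⟨ solve 3 (λ a b c → (a :* b) :* c := a :* (c :* b)) refl _ pivot⁻¹ _ ⟩
      v (punchIn p t) zero * (v p zero * pivot⁻¹)  ≡⟨ cong (v (punchIn p t) zero *_) pivot*pivot⁻¹≡1 ⟩
      v (punchIn p t) zero * 1ℝ                    ≡⟨ *-identityʳ _ ⟩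
      v (punchIn p t) zero                         ∎

    w : Fin m → Vector _
    w t j = v (punchIn p t) (suc j) + - (λ′ t * v p (suc j))

    w-ind : WeaklyIndependent w
    w-ind c c·w≡0 t = subst (λ x → ¬ ¬ x ≡ 0ℝ) (insertAt-punchIn c p γ t) (v-ind c⁺ c⁺·v≡0 (punchIn p t))
      where
      S = Σ[ m ] (λ t → c t * λ′ t)
      γ = - S
      c⁺ = insertAt c p γ

      c⁺·v≡0 : ∀ j → lincomb c⁺ v j ≡ 0ℝ
      c⁺·v≡0 zero = begin
        lincomb c⁺ v zero                                         ≡⟨ lincomb-insertAt v c p γ zero ⟩
        γ * v p zero + Σ[ m ] (λ t → c t * v (punchIn p t) zero)
          ≡⟨ cong (γ * v p zero +_) (Σ-cong {m} (λ t → cong (c t *_) (sym (λ′*pivot t)))) ⟩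
        γ * v p zero + Σ[ m ] (λ t → c t * (λ′ t * v p zero))
          ≡⟨ cong (γ * v p zero +_) (Σ-cong {m} (λ t → sym (*-assoc _ _ _))) ⟩
        γ * v p zero + Σ[ m ] (λ t → (c t * λ′ t) * v p zero)
          ≡⟨ cong (γ * v p zero +_) (sym (*-distribʳ-Σ m (v p zero) _)) ⟩
        γ * v p zero + S * v p zero                               ≡⟨ distribʳ (v p zero) γ S ⟨
        (γ + S) * v p zero                                        ≡⟨ cong (_* v p zero) (-‿inverseˡ S) ⟩
        0ℝ * v p zero                                             ≡⟨ zeroˡ _ ⟩
        0ℝ                                                        ∎
      c⁺·v≡0 (suc j) = begin
        lincomb c⁺ v (suc j)                                ≡⟨ lincomb-insertAt v c p γ (suc j) ⟩
        γ * b + Σ[ m ] a                                    ≡⟨ +-comm _ _ ⟩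
        Σ[ m ] a + - S * b                                  ≡⟨ cong (Σ[ m ] a +_) (-‿distribˡ-* S b) ⟨
        Σ[ m ] a + - (S * b)                                ≡⟨ cong (λ x → Σ[ m ] a + - x) (*-distribʳ-Σ m b _) ⟩
        Σ[ m ] a + - Σ[ m ] (λ t → (c t * λ′ t) * b)        ≡⟨ cong (Σ[ m ] a +_) (Σ-distrib-neg m _) ⟨
        Σ[ m ] a + Σ[ m ] (λ t → - ((c t * λ′ t) * b))      ≡⟨ Σ-distrib-+ m _ _ ⟨
        Σ[ m ] (λ t → a t + - ((c t * λ′ t) * b))
          ≡⟨ Σ-cong {m} (λ t → solve 4 (λ c a l b → c :* a :+ :- ((c :* l) :* b) := c :* (a :+ :- (l :* b)))
                                       refl (c t) (v (punchIn p t) (suc j)) (λ′ t) b) ⟩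
        lincomb c w j                                       ≡⟨ c·w≡0 j ⟩
        0ℝ                                                  ∎
        where
        b = v p (suc j)
        a : Fin m → ℝ
        a t = c t * v (punchIn p t) (suc j)

  weaklyIndependent⇒≤ : ∀ d {m} (v : Fin m → Vector d) → WeaklyIndependent v → ¬ ¬ (m ℕ.≤ d)
  weaklyIndependent⇒≤ d       {zero}  v v-ind = pure ℕ.z≤n
  weaklyIndependent⇒≤ zero    {suc m} v v-ind = v-ind (λ _ → 1ℝ) (λ ()) zero >>= λ 1≡0 → contradiction (sym 1≡0) 0≢1
  weaklyIndependent⇒≤ (suc d) {suc m} v v-ind = ¬¬-excluded-middle >>= by-cases
    where
    by-cases : Dec (Σ (Fin (suc m)) λ p → v p zero ≢ 0ℝ) → ¬ ¬ (suc m ℕ.≤ suc d)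
    by-cases (yes (p , pivot≢0)) =
      let (w , w-ind) = weaklyIndependent-pivot v v-ind p pivot≢0 in ℕ.s≤s <$> weaklyIndependent⇒≤ d w w-ind
    by-cases (no no-pivot) = do
      v₀≡0 ← ¬¬-∀ (λ p v₀≢0 → no-pivot (p , v₀≢0))
      m≤d ← weaklyIndependent⇒≤ d (λ p → v p ∘ suc) (weaklyIndependent-tail v v₀≡0 v-ind)
      pure (ℕ.m≤n⇒m≤1+n m≤d)

  WeaklyIndependentExcept : ∀ {m d} → (Fin m → Vector d) → Fin m → Set
  WeaklyIndependentExcept v i₀ = ∀ c → (∀ j → lincomb c v j ≡ 0ℝ) → c i₀ ≡ 0ℝ → ∀ i → ¬ ¬ c i ≡ 0ℝ

  removeAt-weaklyIndependent : ∀ {m d} (v : Fin (suc m) → Vector d) i₀ →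
    WeaklyIndependentExcept v i₀ → WeaklyIndependent (removeAt v i₀)
  removeAt-weaklyIndependent {m} v i₀ v-ind c c·v≡0 t =
    subst (λ x → ¬ ¬ x ≡ 0ℝ) (insertAt-punchIn c i₀ 0ℝ t)
          (v-ind (insertAt c i₀ 0ℝ) c⁺·v≡0 (insertAt-self c i₀ 0ℝ) (punchIn i₀ t))
    where
    c⁺·v≡0 : ∀ j → lincomb (insertAt c i₀ 0ℝ) v j ≡ 0ℝ
    c⁺·v≡0 j = begin
      lincomb (insertAt c i₀ 0ℝ) v j                  ≡⟨ lincomb-insertAt v c i₀ 0ℝ j ⟩
      0ℝ * v i₀ j + lincomb c (removeAt v i₀) j       ≡⟨ cong (_+ lincomb c (removeAt v i₀) j) (zeroˡ _) ⟩
      0ℝ + lincomb c (removeAt v i₀) j                ≡⟨ +-identityˡ _ ⟩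
      lincomb c (removeAt v i₀) j                     ≡⟨ c·v≡0 j ⟩
      0ℝ                                              ∎

  ⟨⟩-comm : ∀ {d} (x y : Vector d) → ⟨ x , y ⟩ ≡ ⟨ y , x ⟩
  ⟨⟩-comm x y = Σ-cong (λ j → *-comm (x j) (y j))

  ⟨⟩-lincomb : ∀ {d m} (x : Vector d) (β : Fin m → ℝ) (g : Fin m → Vector d) →
    ⟨ x , lincomb β g ⟩ ≡ Σ[ m ] (λ t → β t * ⟨ x , g t ⟩)
  ⟨⟩-lincomb {d} {m} x β g = begin
    Σ[ d ] (λ j → x j * Σ[ m ] (λ t → β t * g t j))    ≡⟨ Σ-cong (λ j → *-distribˡ-Σ m (x j) _) ⟩
    Σ[ d ] (λ j → Σ[ m ] (λ t → x j * (β t * g t j)))  ≡⟨ Σ-cong (λ j → Σ-cong (λ t → x*yz≈y*xz (x j) (β t) (g t j))) ⟩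
    Σ[ d ] (λ j → Σ[ m ] (λ t → β t * (x j * g t j)))  ≡⟨ Σ-comm d m _ ⟩
    Σ[ m ] (λ t → Σ[ d ] (λ j → β t * (x j * g t j)))  ≡⟨ Σ-cong (λ t → *-distribˡ-Σ d (β t) _) ⟨
    Σ[ m ] (λ t → β t * ⟨ x , g t ⟩)                   ∎

  ⟨⟩-lincomb≡0 : ∀ {d m} (x : Vector d) (β : Fin m → ℝ) (g : Fin m → Vector d) →
    (∀ t → ⟨ x , g t ⟩ ≡ 0ℝ) → ⟨ x , lincomb β g ⟩ ≡ 0ℝ
  ⟨⟩-lincomb≡0 x β g x⊥g = trans (⟨⟩-lincomb x β g) (Σ-zero (λ t → trans (cong (β t *_) (x⊥g t)) (zeroʳ _)))

  lincomb-++ : ∀ {a b d} (c : Fin (a ℕ.+ b) → ℝ) (f : Fin a → Vector d) (g : Fin b → Vector d) j →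
    lincomb c (f ++ g) j ≡ lincomb (c ∘ (_↑ˡ b)) f j + lincomb (c ∘ (a ↑ʳ_)) g j
  lincomb-++ {a} {b} c f g j = trans (Σ-++ a b (λ i → c i * (f ++ g) i j))
    (cong₂ _+_ (Σ-cong (λ s → cong (λ h → c (s ↑ˡ b) * h j) (lookup-++ˡ f g s)))
               (Σ-cong (λ t → cong (λ h → c (a ↑ʳ t) * h j) (lookup-++ʳ f g t))))

  -- Positive definiteness: the two partial combinations are orthogonal and sum to zero, so both vanish.
  ++-weaklyIndependent : ∀ {a b d} (f : Fin a → Vector d) (g : Fin b → Vector d) →
    WeaklyIndependent f → WeaklyIndependent g → (∀ s t → ⟨ f s , g t ⟩ ≡ 0ℝ) →
    WeaklyIndependent (f ++ g)
  ++-weaklyIndependent {a} {b} {d} f g f-ind g-ind f⊥g c c·fg≡0 =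
    ↑-cases (λ s → x≡0 >>= λ x≡0 → f-ind α x≡0 s)
            (λ t → x≡0 >>= λ x≡0 → g-ind β (λ j → y≡0 x≡0 j) t)
    where
    α = c ∘ (_↑ˡ b)
    β = c ∘ (a ↑ʳ_)
    x = lincomb α f
    y = lincomb β g

    y≡-x : ∀ j → y j ≡ - x j
    y≡-x j = begin
      y j                  ≡⟨ +-identityˡ _ ⟨
      0ℝ + y j             ≡⟨ cong (_+ y j) (-‿inverseˡ (x j)) ⟨
      (- x j + x j) + y j  ≡⟨ +-assoc _ _ _ ⟩
      - x j + (x j + y j)  ≡⟨ cong (- x j +_) (trans (sym (lincomb-++ c f g j)) (c·fg≡0 j)) ⟩
      - x j + 0ℝ           ≡⟨ +-identityʳ _ ⟩
      - x j                ∎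

    x≡-y : ∀ j → x j ≡ - y j
    x≡-y j = trans (sym (-‿involutive (x j))) (cong -_ (sym (y≡-x j)))

    x⊥g : ∀ t → ⟨ x , g t ⟩ ≡ 0ℝ
    x⊥g t = trans (⟨⟩-comm x (g t)) (⟨⟩-lincomb≡0 (g t) α f (λ s → trans (⟨⟩-comm (g t) (f s)) (f⊥g s t)))

    ⟨x,x⟩≡0 : ⟨ x , x ⟩ ≡ 0ℝ
    ⟨x,x⟩≡0 = begin
      ⟨ x , x ⟩                     ≡⟨ Σ-cong (λ j → cong (x j *_) (x≡-y j)) ⟩
      Σ[ d ] (λ j → x j * - y j)    ≡⟨ Σ-cong (λ j → -‿distribʳ-* (x j) (y j)) ⟨
      Σ[ d ] (λ j → - (x j * y j))  ≡⟨ Σ-distrib-neg d _ ⟩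
      - ⟨ x , y ⟩                   ≡⟨ cong -_ (⟨⟩-lincomb≡0 x β g x⊥g) ⟩
      - 0ℝ                          ≡⟨ -0#≈0# ⟩
      0ℝ                            ∎

    x≡0 : ¬ ¬ (∀ j → x j ≡ 0ℝ)
    x≡0 = ¬¬-∀ (⟨x,x⟩≡0⇒x≡0 x ⟨x,x⟩≡0)

    y≡0 : (∀ j → x j ≡ 0ℝ) → ∀ j → y j ≡ 0ℝ
    y≡0 x≡0 j = trans (y≡-x j) (trans (cong -_ (x≡0 j)) -0#≈0#)

  -- Symmetric matrices

  symUnit : ∀ {k} → Fin k × Fin k → Fin k → Fin k → ℝ
  symUnit (p , q) p′ q′ = I p p′ * I q q′ + I q p′ * I p q′

  symUnit-suc-suc : ∀ {k} (e : Fin k × Fin k) p′ q′ →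
    symUnit (Product.map suc suc e) (suc p′) (suc q′) ≡ symUnit e p′ q′
  symUnit-suc-suc (p , q) p′ q′ = cong₂ _+_ (cong₂ _*_ (I-suc p p′) (I-suc q q′)) (cong₂ _*_ (I-suc q p′) (I-suc p q′))

  symUnit-suc-zero : ∀ {k} (e : Fin k × Fin k) q′ → symUnit (Product.map suc suc e) zero q′ ≡ 0ℝ
  symUnit-suc-zero (p , q) q′ = trans (cong₂ _+_ (zeroˡ _) (zeroˡ _)) (+-identityʳ 0ℝ)

  symUnit-zero-suc : ∀ {k} (q : Fin (suc k)) p′ q′ → symUnit (zero , q) (suc p′) (suc q′) ≡ 0ℝ
  symUnit-zero-suc q p′ q′ = trans (cong₂ _+_ (zeroˡ _) (zeroʳ _)) (+-identityʳ 0ℝ)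

  Σ-symUnit-firstRow : ∀ {k} (α : Fin (suc k) → ℝ) q′ →
    Σ[ suc k ] (λ q → α q * symUnit (zero , q) zero q′) ≡ α q′ + α zero * I zero q′
  Σ-symUnit-firstRow {k} α q′ = begin
    Σ[ suc k ] (λ q → α q * symUnit (zero , q) zero q′)
      ≡⟨ Σ-cong {suc k} (λ q → cong (λ x → α q * (x + I q zero * I zero q′))
                                    (trans (cong (_* I q q′) (I-diag (zero {k}))) (*-identityˡ _))) ⟩
    Σ[ suc k ] (λ q → α q * (I q q′ + I q zero * I zero q′))
      ≡⟨ Σ-cong {suc k} (λ q → solve 4 (λ a x y z → a :* (x :+ y :* z) := a :* x :+ (a :* y) :* z)
                                        refl (α q) (I q q′) (I q zero) (I zero q′)) ⟩
    Σ[ suc k ] (λ q → α q * I q q′ + (α q * I q zero) * I zero q′)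
      ≡⟨ Σ-distrib-+ (suc k) (λ q → α q * I q q′) (λ q → (α q * I q zero) * I zero q′) ⟩
    Σ[ suc k ] (λ q → α q * I q q′) + Σ[ suc k ] (λ q → (α q * I q zero) * I zero q′)
      ≡⟨ cong₂ _+_ (Σ-I′ q′ α) (trans (sym (*-distribʳ-Σ (suc k) (I zero q′) (λ q → α q * I q zero)))
                                      (cong (_* I zero q′) (Σ-I′ zero α))) ⟩
    α q′ + α zero * I zero q′ ∎

  Σ-upperPairs-suc : ∀ k (c : Fin (triangle (suc k)) → ℝ) (F : Fin (suc k) × Fin (suc k) → ℝ) →
    Σ[ triangle (suc k) ] (λ t → c t * F (upperPairs (suc k) t))
      ≡ Σ[ suc k ] (λ q → c (q ↑ˡ triangle k) * F (zero , q))
        + Σ[ triangle k ] (λ t → c (suc k ↑ʳ t) * F (Product.map suc suc (upperPairs k t)))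
  Σ-upperPairs-suc k c F = trans (Σ-++ (suc k) (triangle k) (λ t → c t * F (upperPairs (suc k) t))) (cong₂ _+_
    (Σ-cong {suc k} (λ q → cong (λ e → c (q ↑ˡ triangle k) * F e) (lookup-++ˡ (λ q → zero , q) shifted q)))
    (Σ-cong {triangle k} (λ t → cong (λ e → c (suc k ↑ʳ t) * F e) (lookup-++ʳ (λ q → zero , q) shifted t))))
    where
    shifted = Product.map suc suc ∘ upperPairs k

  symUnits-independent : ∀ k (c : Fin (triangle k) → ℝ) →
    (∀ p′ q′ → Σ[ triangle k ] (λ t → c t * symUnit (upperPairs k t) p′ q′) ≡ 0ℝ) → ∀ t → c t ≡ 0ℝ
  symUnits-independent (suc k) c c·E≡0 = ↑-cases α≡0 β≡0
    where
    α = c ∘ (_↑ˡ triangle k)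
    β = c ∘ (suc k ↑ʳ_)

    first-row : ∀ q′ → α q′ + α zero * I zero q′ ≡ 0ℝ
    first-row q′ = begin
      α q′ + α zero * I zero q′                                ≡⟨ Σ-symUnit-firstRow α q′ ⟨
      Σ[ suc k ] (λ q → α q * symUnit (zero , q) zero q′)      ≡⟨ +-identityʳ _ ⟨
      Σ[ suc k ] (λ q → α q * symUnit (zero , q) zero q′) + 0ℝ
        ≡⟨ cong (Σ[ suc k ] (λ q → α q * symUnit (zero , q) zero q′) +_)
                (Σ-zero {triangle k} (λ t → trans (cong (β t *_) (symUnit-suc-zero (upperPairs k t) q′)) (zeroʳ _))) ⟨
      Σ[ suc k ] (λ q → α q * symUnit (zero , q) zero q′)
        + Σ[ triangle k ] (λ t → β t * symUnit (Product.map suc suc (upperPairs k t)) zero q′)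
        ≡⟨ Σ-upperPairs-suc k c (λ e → symUnit e zero q′) ⟨
      Σ[ triangle (suc k) ] (λ t → c t * symUnit (upperPairs (suc k) t) zero q′)
        ≡⟨ c·E≡0 zero q′ ⟩
      0ℝ ∎

    α₀≡0 : α zero ≡ 0ℝ
    α₀≡0 = x*y≡0⇒x≡0 1+1≢0 (begin
      α zero * (1ℝ + 1ℝ)                   ≡⟨ distribˡ (α zero) 1ℝ 1ℝ ⟩
      α zero * 1ℝ + α zero * 1ℝ            ≡⟨ cong₂ _+_ (*-identityʳ _) (cong (α zero *_) (sym (I-diag (zero {k})))) ⟩
      α zero + α zero * I zero (zero {k})  ≡⟨ first-row zero ⟩
      0ℝ                                   ∎)

    α≡0 : ∀ q → α q ≡ 0ℝ
    α≡0 q = begin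
      α q                          ≡⟨ +-identityʳ _ ⟨
      α q + 0ℝ                     ≡⟨ cong (α q +_) (trans (cong (_* I zero q) α₀≡0) (zeroˡ _)) ⟨
      α q + α zero * I zero q      ≡⟨ first-row q ⟩
      0ℝ                           ∎

    β≡0 : ∀ t → β t ≡ 0ℝ
    β≡0 = symUnits-independent k β λ p′ q′ → begin
      Σ[ triangle k ] (λ t → β t * symUnit (upperPairs k t) p′ q′)
        ≡⟨ +-identityˡ _ ⟨
      0ℝ + Σ[ triangle k ] (λ t → β t * symUnit (upperPairs k t) p′ q′)
        ≡⟨ cong₂ _+_ (Σ-zero {suc k} (λ q → trans (cong (α q *_) (symUnit-zero-suc q p′ q′)) (zeroʳ _)))
                     (Σ-cong {triangle k} (λ t → cong (β t *_) (symUnit-suc-suc (upperPairs k t) p′ q′))) ⟨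
      Σ[ suc k ] (λ q → α q * symUnit (zero , q) (suc p′) (suc q′))
        + Σ[ triangle k ] (λ t → β t * symUnit (Product.map suc suc (upperPairs k t)) (suc p′) (suc q′))
        ≡⟨ Σ-upperPairs-suc k c (λ e → symUnit e (suc p′) (suc q′)) ⟨
      Σ[ triangle (suc k) ] (λ t → c t * symUnit (upperPairs (suc k) t) (suc p′) (suc q′))
        ≡⟨ c·E≡0 (suc p′) (suc q′) ⟩
      0ℝ ∎

  lincomb-Σ : ∀ {m k d} (c : Fin m → ℝ) (β : Fin m → Fin k → ℝ) (v : Fin k → Vector d) j →
    Σ[ m ] (λ t → c t * lincomb (β t) v j) ≡ lincomb (λ i → Σ[ m ] (λ t → c t * β t i)) v j
  lincomb-Σ {m} {k} c β v j = begin
    Σ[ m ] (λ t → c t * Σ[ k ] (λ i → β t i * v i j))      ≡⟨ Σ-cong {m} (λ t → *-distribˡ-Σ k (c t) _) ⟩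
    Σ[ m ] (λ t → Σ[ k ] (λ i → c t * (β t i * v i j)))    ≡⟨ Σ-cong {m} (λ t → Σ-cong {k} (λ i → sym (*-assoc _ _ _))) ⟩
    Σ[ m ] (λ t → Σ[ k ] (λ i → (c t * β t i) * v i j))    ≡⟨ Σ-comm m k _ ⟩
    Σ[ k ] (λ i → Σ[ m ] (λ t → (c t * β t i) * v i j))    ≡⟨ Σ-cong {k} (λ i → *-distribʳ-Σ m (v i j) _) ⟨
    Σ[ k ] (λ i → Σ[ m ] (λ t → c t * β t i) * v i j)      ∎

  bilinear-injective : ∀ {k n} (u : Fin k → Vector n) → LinearlyIndependent u → (M : Fin k → Fin k → ℝ) →
    (∀ a b → lincomb (λ p → lincomb (M p) u b) u a ≡ 0ℝ) → ∀ p q → M p q ≡ 0ℝ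
  bilinear-injective u u-ind M UMUᵀ≡0 p =
    u-ind (M p) (λ b → u-ind (λ p → lincomb (M p) u b) (λ a → UMUᵀ≡0 a b) p)

  Σ-I-pair : ∀ {k} (v : Fin k → ℝ) p q y z → Σ[ k ] (λ i → (I p i * y + I q i * z) * v i) ≡ y * v p + z * v q
  Σ-I-pair {k} v p q y z = begin
    Σ[ k ] (λ i → (I p i * y + I q i * z) * v i)
      ≡⟨ Σ-cong {k} (λ i → solve 5 (λ a y b z v → (a :* y :+ b :* z) :* v := a :* (y :* v) :+ b :* (z :* v))
                                   refl (I p i) y (I q i) z (v i)) ⟩
    Σ[ k ] (λ i → I p i * (y * v i) + I q i * (z * v i))
      ≡⟨ Σ-distrib-+ k _ _ ⟩
    Σ[ k ] (λ i → I p i * (y * v i)) + Σ[ k ] (λ i → I q i * (z * v i))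
      ≡⟨ cong₂ _+_ (Σ-I p (λ i → y * v i)) (Σ-I q (λ i → z * v i)) ⟩
    y * v p + z * v q ∎

  symProduct : ∀ {k n} → (Fin k → Vector n) → Fin k × Fin k → Matrix n n
  symProduct u (p , q) a b = u p a * u q b + u q a * u p b

  symProduct-expand : ∀ {k n} (u : Fin k → Vector n) e a b →
    symProduct u e a b ≡ lincomb (λ p′ → lincomb (symUnit e p′) u b) u a
  symProduct-expand {k} u (p , q) a b = sym (begin
    Σ[ k ] (λ p′ → Σ[ k ] (λ q′ → (I p p′ * I q q′ + I q p′ * I p q′) * u q′ b) * u p′ a)
      ≡⟨ Σ-cong {k} (λ p′ → cong (_* u p′ a)
           (trans (Σ-cong {k} (λ q′ → cong (_* u q′ b) (cong₂ _+_ (*-comm _ _) (*-comm _ _))))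
                  (Σ-I-pair (λ q′ → u q′ b) q p (I p p′) (I q p′)))) ⟩
    Σ[ k ] (λ p′ → (I p p′ * u q b + I q p′ * u p b) * u p′ a)
      ≡⟨ Σ-I-pair (λ p′ → u p′ a) p q (u q b) (u p b) ⟩
    u q b * u p a + u p b * u q a
      ≡⟨ cong₂ _+_ (*-comm _ _) (*-comm _ _) ⟩
    u p a * u q b + u q a * u p b ∎)

  symProducts-independent : ∀ {k n} (u : Fin k → Vector n) → LinearlyIndependent u → (c : Fin (triangle k) → ℝ) →
    (∀ a b → Σ[ triangle k ] (λ t → c t * symProduct u (upperPairs k t) a b) ≡ 0ℝ) → ∀ t → c t ≡ 0ℝ
  symProducts-independent {k} u u-ind c c·Y≡0 = symUnits-independent k c (bilinear-injective u u-ind M UMUᵀ≡0)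
    where
    E = symUnit ∘ upperPairs k
    M : Fin k → Fin k → ℝ
    M p′ q′ = Σ[ triangle k ] (λ t → c t * E t p′ q′)

    UMUᵀ≡0 : ∀ a b → lincomb (λ p → lincomb (M p) u b) u a ≡ 0ℝ
    UMUᵀ≡0 a b = begin
      lincomb (λ p → lincomb (M p) u b) u a
        ≡⟨ Σ-cong {k} (λ p → cong (_* u p a) (lincomb-Σ c (λ t → E t p) u b)) ⟨
      lincomb (λ p → Σ[ triangle k ] (λ t → c t * lincomb (E t p) u b)) u a
        ≡⟨ lincomb-Σ c (λ t p → lincomb (E t p) u b) u a ⟨
      Σ[ triangle k ] (λ t → c t * lincomb (λ p → lincomb (E t p) u b) u a)
        ≡⟨ Σ-cong {triangle k} (λ t → cong (c t *_) (symProduct-expand u (upperPairs k t) a b)) ⟨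
      Σ[ triangle k ] (λ t → c t * symProduct u (upperPairs k t) a b)
        ≡⟨ c·Y≡0 a b ⟩
      0ℝ ∎

  -- Edge coordinates

  Σˡ : ∀ {X : Set} → List X → (X → ℝ) → ℝ
  Σˡ []       h = 0ℝ
  Σˡ (x ∷ xs) h = h x + Σˡ xs h

  Σˡ-lookup : ∀ {X : Set} (xs : List X) (h : X → ℝ) → Σ[ length xs ] (h ∘ lookup xs) ≡ Σˡ xs h
  Σˡ-lookup []       h = refl
  Σˡ-lookup (x ∷ xs) h = cong (h x +_) (Σˡ-lookup xs h)

  Σˡ-++ : ∀ {X : Set} (xs ys : List X) (h : X → ℝ) → Σˡ (xs List.++ ys) h ≡ Σˡ xs h + Σˡ ys h
  Σˡ-++ []       ys h = sym (+-identityˡ _)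
  Σˡ-++ (x ∷ xs) ys h = trans (cong (h x +_) (Σˡ-++ xs ys h)) (sym (+-assoc _ _ _))

  Σˡ-map : ∀ {X Y : Set} (f : X → Y) (xs : List X) (h : Y → ℝ) → Σˡ (List.map f xs) h ≡ Σˡ xs (h ∘ f)
  Σˡ-map f []       h = refl
  Σˡ-map f (x ∷ xs) h = cong (h (f x) +_) (Σˡ-map f xs h)

  Σˡ-cartesianProduct : ∀ {X Y : Set} (xs : List X) (ys : List Y) (h : X × Y → ℝ) →
    Σˡ (cartesianProduct xs ys) h ≡ Σˡ xs (λ x → Σˡ ys (λ y → h (x , y)))
  Σˡ-cartesianProduct []       ys h = refl
  Σˡ-cartesianProduct (x ∷ xs) ys h = trans (Σˡ-++ (List.map (x ,_) ys) _ h)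
    (cong₂ _+_ (Σˡ-map (x ,_) ys h) (Σˡ-cartesianProduct xs ys h))

  Σˡ-filter : ∀ {X : Set} {P : X → Set} (P? : ∀ x → Dec (P x)) (xs : List X) (h : X → ℝ) →
    Σˡ (filter P? xs) h ≡ Σˡ xs (λ x → if does (P? x) then h x else 0ℝ)
  Σˡ-filter P? []       h = refl
  Σˡ-filter P? (x ∷ xs) h with does (P? x)
  ... | true  = cong (h x +_) (Σˡ-filter P? xs h)
  ... | false = trans (Σˡ-filter P? xs h) (sym (+-identityˡ _))

  Σˡ-tabulate : ∀ {X : Set} {m} (g : Fin m → X) (h : X → ℝ) → Σˡ (List.tabulate g) h ≡ Σ[ m ] (h ∘ g)
  Σˡ-tabulate {m = zero}  g h = refl
  Σˡ-tabulate {m = suc m} g h = cong (h (g zero) +_) (Σˡ-tabulate (g ∘ suc) h)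

  module EdgeCoordinates {n} (G : Graph n) where

    -- edgeList G lists each edge once, as the pair (a , b) with a < b.
    isEdge : Fin n → Fin n → Bool
    isEdge a b = does (toℕ a ℕ.<? toℕ b) ∧ adj G a b

    edge : Fin (e G) → Fin n × Fin n
    edge = lookup (edgeList G)

    Σ-edges : ∀ (h : Fin n → Fin n → ℝ) →
      Σ[ e G ] (uncurry h ∘ edge) ≡ Σ[ n ] (λ a → Σ[ n ] (λ b → if isEdge a b then h a b else 0ℝ))
    Σ-edges h = begin
      Σ[ e G ] (uncurry h ∘ edge)                            ≡⟨ Σˡ-lookup (edgeList G) (uncurry h) ⟩
      Σˡ (edgeList G) (uncurry h)                             ≡⟨ Σˡ-filter _ (cartesianProduct (allFin n) (allFin n)) (uncurry h) ⟩
      Σˡ (cartesianProduct (allFin n) (allFin n)) (uncurry h′) ≡⟨ Σˡ-cartesianProduct (allFin n) (allFin n) (uncurry h′) ⟩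
      Σˡ (allFin n) (λ a → Σˡ (allFin n) (h′ a))              ≡⟨ Σˡ-tabulate id (λ a → Σˡ (allFin n) (h′ a)) ⟩
      Σ[ n ] (λ a → Σˡ (allFin n) (h′ a))                     ≡⟨ Σ-cong {n} (λ a → Σˡ-tabulate id (h′ a)) ⟩
      Σ[ n ] (λ a → Σ[ n ] (h′ a))
        ≡⟨ Σ-cong {n} (λ a → Σ-cong {n} (λ b → cong (if_then h a b else 0ℝ) (does-≟-true (isEdge a b)))) ⟩
      Σ[ n ] (λ a → Σ[ n ] (λ b → if isEdge a b then h a b else 0ℝ)) ∎
      where
      h′ : Fin n → Fin n → ℝ
      h′ a b = if does (isEdge a b Bool.≟ true) then h a b else 0ℝ

      does-≟-true : ∀ b → does (b Bool.≟ true) ≡ b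
      does-≟-true true  = refl
      does-≟-true false = refl

    edge-complete : ∀ {a b} → isEdge a b ≡ true → Σ (Fin (e G)) λ s → edge s ≡ (a , b)
    edge-complete {a} {b} ab-edge = Any.index ab∈edges , sym (Any.lookup-index ab∈edges)
      where
      ab∈edges : (a , b) ∈ edgeList G
      ab∈edges = ∈-filter⁺ _ (∈-cartesianProduct⁺ (∈-allFin a) (∈-allFin b)) ab-edge

    isEdge-< : ∀ {a b} → toℕ a ℕ.< toℕ b → adj G a b ≡ true → isEdge a b ≡ true
    isEdge-< {a} {b} a<b a~b = cong₂ _∧_ (dec-true (toℕ a ℕ.<? toℕ b) a<b) a~b

    isEdge-≮ : ∀ {a b} → ¬ toℕ a ℕ.< toℕ b → isEdge a b ≡ false
    isEdge-≮ {a} {b} a≮b = cong (_∧ adj G a b) (dec-false (toℕ a ℕ.<? toℕ b) a≮b)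

    isEdge-nonadjacent : ∀ {a b} → adj G a b ≡ false → isEdge a b ≡ false
    isEdge-nonadjacent {a} {b} a≁b = trans (cong (does (toℕ a ℕ.<? toℕ b) ∧_) a≁b) (Bool.∧-zeroʳ _)

    isEdge-orientation : ∀ {a b} → a ≢ b → adj G a b ≡ true →
      (isEdge a b ≡ true × isEdge b a ≡ false) ⊎ (isEdge a b ≡ false × isEdge b a ≡ true)
    isEdge-orientation {a} {b} a≢b a~b with ℕ.<-cmp (toℕ a) (toℕ b)
    ... | tri< a<b _ _ = inj₁ (isEdge-< a<b a~b , isEdge-≮ (ℕ.<-asym a<b))
    ... | tri≈ _ a≡b _ = contradiction (Fin.toℕ-injective a≡b) a≢b
    ... | tri> _ _ b<a = inj₂ (isEdge-≮ (ℕ.<-asym b<a) , isEdge-< b<a (trans (adj-sym G b a) a~b))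

    edges-cover : (P : Fin n → Fin n → Set) → (∀ {a b} → P a b → P b a) →
      (∀ s {a b} → edge s ≡ (a , b) → a ≢ b → adj G a b ≡ true → P a b) →
      ∀ {a b} → a ≢ b → adj G a b ≡ true → P a b
    edges-cover P P-sym P-edges {a} {b} a≢b a~b with isEdge-orientation a≢b a~b
    ... | inj₁ (ab-edge , _) = let (s , eₛ≡ab) = edge-complete ab-edge in P-edges s eₛ≡ab a≢b a~b
    ... | inj₂ (_ , ba-edge) = let (s , eₛ≡ba) = edge-complete ba-edge in
      P-sym (P-edges s eₛ≡ba (a≢b ∘ sym) (trans (adj-sym G b a) a~b))

    Σ-incident : ∀ (Z : Fin n → Fin n → ℝ) l →
      Σ[ n ] (λ a → Σ[ n ] (λ b → if isEdge a b then (I l a + I l b) * Z a b else 0ℝ))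
        ≡ Σ[ n ] (λ m → (if isEdge l m then Z l m else 0ℝ) + (if isEdge m l then Z m l else 0ℝ))
    Σ-incident Z l = begin
      Σ[ n ] (λ a → Σ[ n ] (λ b → if isEdge a b then (I l a + I l b) * Z a b else 0ℝ))
        ≡⟨ Σ-cong {n} (λ a → Σ-cong {n} (λ b → split-incidence (isEdge a b) (I l a) (I l b) (Z a b))) ⟩
      Σ[ n ] (λ a → Σ[ n ] (λ b → I l a * W a b + I l b * W a b))
        ≡⟨ Σ-cong {n} (λ a → Σ-distrib-+ n _ _) ⟩
      Σ[ n ] (λ a → Σ[ n ] (λ b → I l a * W a b) + Σ[ n ] (λ b → I l b * W a b))
        ≡⟨ Σ-distrib-+ n _ _ ⟩
      Σ[ n ] (λ a → Σ[ n ] (λ b → I l a * W a b)) + Σ[ n ] (λ a → Σ[ n ] (λ b → I l b * W a b))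
        ≡⟨ cong₂ _+_ (trans (Σ-cong {n} (λ a → sym (*-distribˡ-Σ n (I l a) (W a)))) (Σ-I l (λ a → Σ[ n ] (W a))))
                     (trans (Σ-comm n n _) (trans (Σ-cong {n} (λ b → sym (*-distribˡ-Σ n (I l b) (λ a → W a b))))
                                                  (Σ-I l (λ b → Σ[ n ] (λ a → W a b))))) ⟩
      Σ[ n ] (W l) + Σ[ n ] (λ m → W m l)
        ≡⟨ Σ-distrib-+ n (W l) (λ m → W m l) ⟨
      Σ[ n ] (λ m → W l m + W m l) ∎
      where
      W : Fin n → Fin n → ℝ
      W a b = if isEdge a b then Z a b else 0ℝ

      split-incidence : ∀ e x y z → (if e then (x + y) * z else 0ℝ) ≡ x * (if e then z else 0ℝ) + y * (if e then z else 0ℝ)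
      split-incidence true  x y z = distribʳ z x y
      split-incidence false x y z = sym (trans (cong₂ _+_ (zeroʳ x) (zeroʳ y)) (+-identityʳ 0ℝ))

    incidence-count : ∀ l m z → (l ≢ m → adj G l m ≡ false → z ≡ 0ℝ) →
      (if isEdge l m then z else 0ℝ) + (if isEdge m l then z else 0ℝ) + I l m * z ≡ z
    incidence-count l m z z-offEdge = by-equality (l Fin.≟ m)
      where
      Count : Bool → Bool → ℝ → Set
      Count b₁ b₂ δ = (if b₁ then z else 0ℝ) + (if b₂ then z else 0ℝ) + δ * z ≡ z

      tally : ∀ {b₁ b₂ δ} → isEdge l m ≡ b₁ → isEdge m l ≡ b₂ → I l m ≡ δ →
        Count b₁ b₂ δ → Count (isEdge l m) (isEdge m l) (I l m)
      tally ≡.refl ≡.refl ≡.refl count = count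

      by-adjacency : l ≢ m → ∀ b → adj G l m ≡ b → Count (isEdge l m) (isEdge m l) (I l m)
      by-adjacency l≢m false l≁m =
        tally (isEdge-nonadjacent l≁m) (isEdge-nonadjacent (trans (adj-sym G m l) l≁m)) (I-offDiag l≢m)
              (trans (solve 1 (λ z → con (ℤ.+ 0) :+ con (ℤ.+ 0) :+ con (ℤ.+ 0) :* z := con (ℤ.+ 0)) refl z)
                     (sym (z-offEdge l≢m l≁m)))
      by-adjacency l≢m true l~m with isEdge-orientation l≢m l~m
      ... | inj₁ (lm , ml) = tally lm ml (I-offDiag l≢m) (solve 1 (λ z → z :+ con (ℤ.+ 0) :+ con (ℤ.+ 0) :* z := z) refl z)
      ... | inj₂ (lm , ml) = tally lm ml (I-offDiag l≢m) (solve 1 (λ z → con (ℤ.+ 0) :+ z :+ con (ℤ.+ 0) :* z := z) refl z)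

      by-equality : Dec (l ≡ m) → Count (isEdge l m) (isEdge m l) (I l m)
      by-equality (yes ≡.refl) = tally (isEdge-≮ (ℕ.<-irrefl refl)) (isEdge-≮ (ℕ.<-irrefl refl)) (I-diag l)
        (trans (cong (_+ 1ℝ * z) (+-identityʳ 0ℝ)) (trans (+-identityˡ _) (*-identityˡ z)))
      by-equality (no l≢m) = by-adjacency l≢m (adj G l m) refl

  ⟨⟩-++ : ∀ {a b} (x₁ y₁ : Vector a) (x₂ y₂ : Vector b) →
    ⟨ x₁ ++ x₂ , y₁ ++ y₂ ⟩ ≡ ⟨ x₁ , y₁ ⟩ + ⟨ x₂ , y₂ ⟩
  ⟨⟩-++ {a} {b} x₁ y₁ x₂ y₂ = trans (Σ-++ a b (λ j → (x₁ ++ x₂) j * (y₁ ++ y₂) j))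
    (cong₂ _+_ (Σ-cong (λ s → cong₂ _*_ (lookup-++ˡ x₁ x₂ s) (lookup-++ˡ y₁ y₂ s)))
               (Σ-cong (λ t → cong₂ _*_ (lookup-++ʳ x₁ x₂ t) (lookup-++ʳ y₁ y₂ t))))

  -- The Strong Arnold Hypothesis

  I∘-diagonal≡0 : ∀ {n} (X : Matrix n n) → (∀ i → X i i ≡ 0ℝ) → ∀ a b → I a b * X a b ≡ 0ℝ
  I∘-diagonal≡0 X X-diag a b = by-cases (a Fin.≟ b)
    where
    by-cases : Dec (a ≡ b) → I a b * X a b ≡ 0ℝ
    by-cases (yes ≡.refl) = trans (cong (I a a *_) (X-diag a)) (zeroʳ _)
    by-cases (no a≢b)     = trans (cong (_* X a b) (I-offDiag a≢b)) (zeroˡ _)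

  ZeroRow : ∀ {k n} → (Fin k → Vector n) → Fin n → Set
  ZeroRow u l = ∀ p → u p l ≡ 0ℝ

  module StrongArnold {n} {G : Graph n} {A : Matrix n n}
    (A-sym : Symmetric A) (A-graph : HasGraph A G) (A-sah : SAH A)
    (A-offEdge : ∀ a b → a ≢ b → adj G a b ≡ false → A a b ≡ 0ℝ) where

    open EdgeCoordinates G

    Annihilated : Matrix n n → Set
    Annihilated X = ∀ a b → (A · X) a b ≡ 0ℝ

    _⊗_ : Vector n → Vector n → Matrix n n
    (x ⊗ y) a b = x a * y b

    ⊗-annihilated : ∀ {x} → InKernel A x → ∀ y → Annihilated (x ⊗ y)
    ⊗-annihilated {x} Ax≡0 y a b = begin
      Σ[ n ] (λ l → A a l * (x l * y b))   ≡⟨ Σ-cong (λ l → sym (*-assoc (A a l) (x l) (y b))) ⟩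
      Σ[ n ] (λ l → A a l * x l * y b)     ≡⟨ *-distribʳ-Σ n (y b) _ ⟨
      (A ⊛ x) a * y b                      ≡⟨ cong (_* y b) (Ax≡0 a) ⟩
      0ℝ * y b                             ≡⟨ zeroˡ _ ⟩
      0ℝ                                   ∎

    +-annihilated : ∀ {X Y} → Annihilated X → Annihilated Y → Annihilated (λ a b → X a b + Y a b)
    +-annihilated {X} {Y} AX≡0 AY≡0 a b = begin
      Σ[ n ] (λ l → A a l * (X l b + Y l b))          ≡⟨ Σ-cong (λ l → distribˡ (A a l) _ _) ⟩
      Σ[ n ] (λ l → A a l * X l b + A a l * Y l b)    ≡⟨ Σ-distrib-+ n _ _ ⟩
      (A · X) a b + (A · Y) a b                       ≡⟨ cong₂ _+_ (AX≡0 a b) (AY≡0 a b) ⟩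
      0ℝ + 0ℝ                                         ≡⟨ +-identityʳ 0ℝ ⟩
      0ℝ                                              ∎

    neg-annihilated : ∀ {X} → Annihilated X → Annihilated (λ a b → - X a b)
    neg-annihilated {X} AX≡0 a b = begin
      Σ[ n ] (λ l → A a l * - X l b)      ≡⟨ Σ-cong (λ l → -‿distribʳ-* (A a l) (X l b)) ⟨
      Σ[ n ] (λ l → - (A a l * X l b))    ≡⟨ Σ-distrib-neg n _ ⟩
      - (A · X) a b                       ≡⟨ cong -_ (AX≡0 a b) ⟩
      - 0ℝ                                ≡⟨ -0#≈0# ⟩
      0ℝ                                  ∎

    lincomb-annihilated : ∀ {m} (c : Fin m → ℝ) (Y : Fin m → Matrix n n) → (∀ t → Annihilated (Y t)) →
      Annihilated (λ a b → Σ[ m ] (λ t → c t * Y t a b))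
    lincomb-annihilated {m} c Y AY≡0 a b = begin
      Σ[ n ] (λ l → A a l * Σ[ m ] (λ t → c t * Y t l b))
        ≡⟨ Σ-cong {n} (λ l → *-distribˡ-Σ m (A a l) _) ⟩
      Σ[ n ] (λ l → Σ[ m ] (λ t → A a l * (c t * Y t l b)))
        ≡⟨ Σ-cong {n} (λ l → Σ-cong {m} (λ t → x*yz≈y*xz _ _ _)) ⟩
      Σ[ n ] (λ l → Σ[ m ] (λ t → c t * (A a l * Y t l b)))
        ≡⟨ Σ-comm n m _ ⟩
      Σ[ m ] (λ t → Σ[ n ] (λ l → c t * (A a l * Y t l b)))
        ≡⟨ Σ-cong {m} (λ t → *-distribˡ-Σ n (c t) _) ⟨
      Σ[ m ] (λ t → c t * (A · Y t) a b)
        ≡⟨ Σ-zero (λ t → trans (cong (c t *_) (AY≡0 t a b)) (zeroʳ _)) ⟩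
      0ℝ ∎

    scale-inKernel : ∀ (q : Vector n) → (∀ a b → A a b * q b ≡ q a * A a b) →
      ∀ {v} → InKernel A v → InKernel A (λ a → q a * v a)
    scale-inKernel q Aq≡qA {v} Av≡0 a = begin
      Σ[ n ] (λ l → A a l * (q l * v l))   ≡⟨ Σ-cong {n} (λ l → sym (*-assoc (A a l) (q l) (v l))) ⟩
      Σ[ n ] (λ l → (A a l * q l) * v l)   ≡⟨ Σ-cong {n} (λ l → trans (cong (_* v l) (Aq≡qA a l)) (*-assoc _ _ _)) ⟩
      Σ[ n ] (λ l → q a * (A a l * v l))   ≡⟨ *-distribˡ-Σ n (q a) _ ⟨
      q a * (A ⊛ v) a                      ≡⟨ cong (q a *_) (Av≡0 a) ⟩
      q a * 0ℝ                             ≡⟨ zeroʳ _ ⟩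
      0ℝ                                   ∎

    restrict : Matrix n n → Vector (e G ℕ.+ n)
    restrict X = (uncurry X ∘ edge) ++ (λ i → X i i)

    restrict≡0⇒≡0 : ∀ {X} → Symmetric X → Annihilated X → (∀ k → restrict X k ≡ 0ℝ) → ∀ a b → X a b ≡ 0ℝ
    restrict≡0⇒≡0 {X} X-sym AX≡0 X∣≡0 = A-sah X X-sym AX≡0 A∘X≡0 (I∘-diagonal≡0 X X-diag)
      where
      X-diag : ∀ i → X i i ≡ 0ℝ
      X-diag i = trans (sym (lookup-++ʳ (uncurry X ∘ edge) _ i)) (X∣≡0 (e G ↑ʳ i))

      X-edges : ∀ s {a b} → edge s ≡ (a , b) → a ≢ b → adj G a b ≡ true → X a b ≡ 0ℝ
      X-edges s eₛ≡ab _ _ = trans (cong (uncurry X) (sym eₛ≡ab))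
                                  (trans (sym (lookup-++ˡ _ (λ i → X i i) s)) (X∣≡0 (s ↑ˡ n)))

      A∘X≡0 : ∀ a b → A a b * X a b ≡ 0ℝ
      A∘X≡0 a b with a Fin.≟ b
      ... | yes ≡.refl = trans (cong (A a a *_) (X-diag a)) (zeroʳ _)
      ... | no a≢b with adj G a b in a~b
      ...   | true  = trans (cong (A a b *_) (edges-cover (λ a b → X a b ≡ 0ℝ) (trans (X-sym _ _)) X-edges a≢b a~b)) (zeroʳ _)
      ...   | false = trans (cong (_* X a b) (A-offEdge a b a≢b a~b)) (zeroˡ _)

    -- Strong Arnold applied to X = (q²u) ⊗ w + w ⊗ (q²u) − (qu) ⊗ (qw) − (qw) ⊗ (qu), which is symmetric,
    -- annihilated by A (diag q commutes with A) and vanishes wherever q a = q b, in particular on edges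
    -- and on the diagonal.
    commuting-diagonal-lemma : ∀ (q : Vector n) → (∀ a b → A a b * q b ≡ q a * A a b) →
      ∀ {u w} → InKernel A u → InKernel A w → ∀ i j → q j ≡ 0ℝ → ((q i * q i) * u i) * w j ≡ 0ℝ
    commuting-diagonal-lemma q Aq≡qA {u} {w} Au≡0 Aw≡0 i j qⱼ≡0 = begin
      ((q i * q i) * u i) * w j
        ≡⟨ solve 5 (λ qi ui wi wj uj → ((qi :* qi) :* ui) :* wj
                                      := (qi :+ :- con (ℤ.+ 0)) :* (qi :* ui :* wj :+ :- (con (ℤ.+ 0) :* wi :* uj)))
                   refl (q i) (u i) (w i) (w j) (u j) ⟩
      (q i + - 0ℝ) * (q i * u i * w j + - (0ℝ * w i * u j))
        ≡⟨ cong (λ x → (q i + - x) * (q i * u i * w j + - (x * w i * u j))) (sym qⱼ≡0) ⟩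
      (q i + - q j) * Z i j                                   ≡⟨ X-factor i j ⟨
      X i j                                                   ≡⟨ X≡0 i j ⟩
      0ℝ                                                      ∎
      where
      qu qqu qw : Vector n
      qu a = q a * u a
      qqu a = q a * qu a
      qw a = q a * w a

      X : Matrix n n
      X a b = (qqu ⊗ w) a b + (w ⊗ qqu) a b + - (qu ⊗ qw) a b + - (qw ⊗ qu) a b

      Z : Matrix n n
      Z a b = q a * u a * w b + - (q b * w a * u b)

      X-factor : ∀ a b → X a b ≡ (q a + - q b) * Z a b
      X-factor a b = solve 6 (λ qa qb ua ub wa wb →
          (qa :* (qa :* ua)) :* wb :+ wa :* (qb :* (qb :* ub)) :+ :- ((qa :* ua) :* (qb :* wb)) :+ :- ((qa :* wa) :* (qb :* ub))
          := (qa :+ :- qb) :* (qa :* ua :* wb :+ :- (qb :* wa :* ub)))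
        refl (q a) (q b) (u a) (u b) (w a) (w b)

      X-sym : Symmetric X
      X-sym a b = solve 6 (λ qa qb ua ub wa wb →
          (qa :* (qa :* ua)) :* wb :+ wa :* (qb :* (qb :* ub)) :+ :- ((qa :* ua) :* (qb :* wb)) :+ :- ((qa :* wa) :* (qb :* ub))
          := (qb :* (qb :* ub)) :* wa :+ wb :* (qa :* (qa :* ua)) :+ :- ((qb :* ub) :* (qa :* wa)) :+ :- ((qb :* wb) :* (qa :* ua)))
        refl (q a) (q b) (u a) (u b) (w a) (w b)

      AX≡0 : Annihilated X
      AX≡0 = +-annihilated (+-annihilated (+-annihilated (⊗-annihilated Aqqu≡0 w) (⊗-annihilated Aw≡0 qqu))
                                          (neg-annihilated (⊗-annihilated Aqu≡0 qw)))
                           (neg-annihilated (⊗-annihilated Aqw≡0 qu))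
        where
        Aqu≡0 = scale-inKernel q Aq≡qA Au≡0
        Aqqu≡0 = scale-inKernel q Aq≡qA Aqu≡0
        Aqw≡0 = scale-inKernel q Aq≡qA Aw≡0

      A∘X≡0 : ∀ a b → A a b * X a b ≡ 0ℝ
      A∘X≡0 a b = begin
        A a b * X a b                                    ≡⟨ cong (A a b *_) (X-factor a b) ⟩
        A a b * ((q a + - q b) * Z a b)
          ≡⟨ solve 4 (λ x qa qb z → x :* ((qa :+ :- qb) :* z) := (qa :* x :+ :- (x :* qb)) :* z)
                     refl (A a b) (q a) (q b) (Z a b) ⟩
        (q a * A a b + - (A a b * q b)) * Z a b          ≡⟨ cong (λ x → (q a * A a b + - x) * Z a b) (Aq≡qA a b) ⟩
        (q a * A a b + - (q a * A a b)) * Z a b          ≡⟨ cong (_* Z a b) (-‿inverseʳ _) ⟩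
        0ℝ * Z a b                                       ≡⟨ zeroˡ _ ⟩
        0ℝ                                               ∎

      X-diag : ∀ a → X a a ≡ 0ℝ
      X-diag a = trans (X-factor a a) (trans (cong (_* Z a a) (-‿inverseʳ (q a))) (zeroˡ _))

      X≡0 : ∀ a b → X a b ≡ 0ℝ
      X≡0 = A-sah X X-sym AX≡0 A∘X≡0 (I∘-diagonal≡0 X X-diag)

    diagUnit : Fin n → Vector (e G ℕ.+ n)
    diagUnit l = (λ _ → 0ℝ) ++ I l

    incidence : Fin n → Fin n → Fin n → ℝ
    incidence l a b = (I l a + I l b) * A a b

    -- The coordinates of the linear functional X ↦ (A · X) l l on symmetric matrices.
    rowFunctional : Fin n → Vector (e G ℕ.+ n)
    rowFunctional l = (uncurry (incidence l) ∘ edge) ++ (λ i → I l i * A l l)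

    ⟨restrict,diagUnit⟩ : ∀ X l → ⟨ restrict X , diagUnit l ⟩ ≡ X l l
    ⟨restrict,diagUnit⟩ X l = begin
      ⟨ restrict X , diagUnit l ⟩                                      ≡⟨ ⟨⟩-++ (uncurry X ∘ edge) _ (λ i → X i i) (I l) ⟩
      ⟨ uncurry X ∘ edge , (λ _ → 0ℝ) ⟩ + ⟨ (λ i → X i i) , I l ⟩
        ≡⟨ cong₂ _+_ (Σ-zero {e G} (λ s → zeroʳ _))
                     (trans (Σ-cong {n} (λ i → *-comm (X i i) (I l i))) (Σ-I l (λ i → X i i))) ⟩
      0ℝ + X l l                                                       ≡⟨ +-identityˡ _ ⟩
      X l l                                                            ∎

    ⟨restrict,rowFunctional⟩ : ∀ {X} → Symmetric X → ∀ l → ⟨ restrict X , rowFunctional l ⟩ ≡ (A · X) l l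
    ⟨restrict,rowFunctional⟩ {X} X-sym l = begin
      ⟨ restrict X , rowFunctional l ⟩
        ≡⟨ ⟨⟩-++ (uncurry X ∘ edge) (uncurry (incidence l) ∘ edge) (λ i → X i i) (λ i → I l i * A l l) ⟩
      Σ[ e G ] (λ s → uncurry X (edge s) * uncurry (incidence l) (edge s)) + Σ[ n ] (λ i → X i i * (I l i * A l l))
        ≡⟨ cong₂ _+_ (Σ-edges (λ a b → X a b * incidence l a b)) diagonal-term ⟩
      Σ[ n ] (λ a → Σ[ n ] (λ b → if isEdge a b then X a b * incidence l a b else 0ℝ)) + Σ[ n ] (λ m → I l m * z m)
        ≡⟨ cong (_+ Σ[ n ] (λ m → I l m * z m))
                (trans (Σ-cong {n} (λ a → Σ-cong {n} (λ b → cong (if isEdge a b then_else 0ℝ) (edge-term a b))))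
                       (Σ-incident (λ a b → A a b * X a b) l)) ⟩
      Σ[ n ] (λ m → (if isEdge l m then A l m * X l m else 0ℝ) + (if isEdge m l then A m l * X m l else 0ℝ))
        + Σ[ n ] (λ m → I l m * z m)
        ≡⟨ Σ-distrib-+ n _ _ ⟨
      Σ[ n ] (λ m → (if isEdge l m then A l m * X l m else 0ℝ) + (if isEdge m l then A m l * X m l else 0ℝ) + I l m * z m)
        ≡⟨ Σ-cong {n} (λ m → trans
             (cong₂ (λ x y → (if isEdge l m then x else 0ℝ) + (if isEdge m l then y else 0ℝ) + I l m * z m)
                    (cong (A l m *_) (X-sym l m)) (cong (_* X m l) (A-sym m l)))
             (incidence-count l m (z m) (λ l≢m l≁m → trans (cong (_* X m l) (A-offEdge l m l≢m l≁m)) (zeroˡ _)))) ⟩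
      Σ[ n ] z ∎
      where
      z : Fin n → ℝ
      z m = A l m * X m l

      edge-term : ∀ a b → X a b * incidence l a b ≡ (I l a + I l b) * (A a b * X a b)
      edge-term a b = trans (x*yz≈y*xz _ _ _) (cong ((I l a + I l b) *_) (*-comm (X a b) (A a b)))

      diagonal-term : Σ[ n ] (λ i → X i i * (I l i * A l l)) ≡ Σ[ n ] (λ m → I l m * z m)
      diagonal-term = begin
        Σ[ n ] (λ i → X i i * (I l i * A l l))
          ≡⟨ Σ-cong {n} (λ i → solve 3 (λ x δ a → x :* (δ :* a) := δ :* (a :* x)) refl (X i i) (I l i) (A l l)) ⟩
        Σ[ n ] (λ i → I l i * (A l l * X i i))   ≡⟨ Σ-I l (λ i → A l l * X i i) ⟩
        A l l * X l l                            ≡⟨ Σ-I l z ⟨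
        Σ[ n ] (λ m → I l m * z m)               ∎

    edgeConstant⇒commutes : ∀ (q : Vector n) → (∀ {a b} → a ≢ b → adj G a b ≡ true → q a ≡ q b) →
      ∀ a b → A a b * q b ≡ q a * A a b
    edgeConstant⇒commutes q q-const a b = by-equality (a Fin.≟ b)
      where
      by-adjacency : a ≢ b → ∀ x → adj G a b ≡ x → A a b * q b ≡ q a * A a b
      by-adjacency a≢b true  a~b = trans (*-comm _ _) (cong (_* A a b) (sym (q-const a≢b a~b)))
      by-adjacency a≢b false a≁b = trans (cong (_* q b) A≡0) (trans (zeroˡ _) (sym (trans (cong (q a *_) A≡0) (zeroʳ _))))
        where
        A≡0 = A-offEdge a b a≢b a≁b

      by-equality : Dec (a ≡ b) → A a b * q b ≡ q a * A a b
      by-equality (yes ≡.refl) = *-comm _ _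
      by-equality (no a≢b)     = by-adjacency a≢b (adj G a b) refl

    module KernelBasis {k} (u : Fin k → Vector n) (u-kernel : ∀ p → InKernel A (u p)) (u-ind : LinearlyIndependent u) where

      symProduct-annihilated : ∀ e → Annihilated (symProduct u e)
      symProduct-annihilated (p , q) = +-annihilated (⊗-annihilated (u-kernel p) (u q)) (⊗-annihilated (u-kernel q) (u p))

      symProduct-sym : ∀ e → Symmetric (symProduct u e)
      symProduct-sym (p , q) a b = trans (+-comm _ _) (cong₂ _+_ (*-comm _ _) (*-comm _ _))

      symProductCoordinates : Fin (triangle k) → Vector (e G ℕ.+ n)
      symProductCoordinates t = restrict (symProduct u (upperPairs k t))

      restrict-lincomb : ∀ {m} (c : Fin m → ℝ) (Y : Fin m → Matrix n n) →
        ∀ j → restrict (λ a b → Σ[ m ] (λ t → c t * Y t a b)) j ≡ lincomb c (restrict ∘ Y) j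
      restrict-lincomb {m} c Y = ↑-cases
        (λ s → trans (lookup-++ˡ (uncurry X ∘ edge) (λ i → X i i) s)
                     (Σ-cong {m} (λ t → cong (c t *_) (sym (lookup-++ˡ (uncurry (Y t) ∘ edge) (λ i → Y t i i) s)))))
        (λ i → trans (lookup-++ʳ (uncurry X ∘ edge) (λ i → X i i) i)
                     (Σ-cong {m} (λ t → cong (c t *_) (sym (lookup-++ʳ (uncurry (Y t) ∘ edge) (λ i → Y t i i) i)))))
        where
        X : Matrix n n
        X a b = Σ[ m ] (λ t → c t * Y t a b)

      symProductCoordinates-independent : WeaklyIndependent symProductCoordinates
      symProductCoordinates-independent c c·Y∣≡0 = pure ∘ symProducts-independent u u-ind c
        (restrict≡0⇒≡0 (λ a b → Σ-cong (λ t → cong (c t *_) (symProduct-sym (upperPairs k t) a b)))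
                       (lincomb-annihilated c Y (symProduct-annihilated ∘ upperPairs k))
                       (λ j → trans (restrict-lincomb c Y j) (c·Y∣≡0 j)))
        where
        Y = symProduct u ∘ upperPairs k

      constraint : ∀ l → Dec (ZeroRow u l) → Vector (e G ℕ.+ n)
      constraint l (yes _) = diagUnit l
      constraint l (no _)  = rowFunctional l

      constraint⊥symProductCoordinates : ∀ t l d → ⟨ symProductCoordinates t , constraint l d ⟩ ≡ 0ℝ
      constraint⊥symProductCoordinates t l (yes zero-row) = begin
        ⟨ restrict (symProduct u (p , q)) , diagUnit l ⟩   ≡⟨ ⟨restrict,diagUnit⟩ (symProduct u (p , q)) l ⟩
        u p l * u q l + u q l * u p l
          ≡⟨ cong₂ _+_ (cong (_* u q l) (zero-row p)) (cong (_* u p l) (zero-row q)) ⟩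
        0ℝ * u q l + 0ℝ * u p l                            ≡⟨ trans (cong₂ _+_ (zeroˡ _) (zeroˡ _)) (+-identityʳ 0ℝ) ⟩
        0ℝ                                                 ∎
        where
        p = proj₁ (upperPairs k t)
        q = proj₂ (upperPairs k t)
      constraint⊥symProductCoordinates t l (no _) =
        trans (⟨restrict,rowFunctional⟩ (symProduct-sym (upperPairs k t)) l) (symProduct-annihilated (upperPairs k t) l l)

      diagonalWeight : ∀ l → Dec (ZeroRow u l) → ℝ
      diagonalWeight l (yes _) = 1ℝ
      diagonalWeight l (no _)  = A l l

      constraint-diagonal : ∀ l d i → constraint l d (e G ↑ʳ i) ≡ I l i * diagonalWeight l d
      constraint-diagonal l (yes _) i = trans (lookup-++ʳ (λ (_ : Fin (e G)) → 0ℝ) (I l) i) (sym (*-identityʳ _))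
      constraint-diagonal l (no _)  i = lookup-++ʳ (uncurry (incidence l) ∘ edge) (λ i → I l i * A l l) i

      module _ (zeroRow? : ∀ l → Dec (ZeroRow u l)) where

        constraints : Fin n → Vector (e G ℕ.+ n)
        constraints l = constraint l (zeroRow? l)

        lincomb-constraints-diagonal : ∀ c i → lincomb c constraints (e G ↑ʳ i) ≡ c i * diagonalWeight i (zeroRow? i)
        lincomb-constraints-diagonal c i = begin
          Σ[ n ] (λ l → c l * constraints l (e G ↑ʳ i))
            ≡⟨ Σ-cong {n} (λ l → cong (c l *_) (constraint-diagonal l (zeroRow? l) i)) ⟩
          Σ[ n ] (λ l → c l * (I l i * diagonalWeight l (zeroRow? l)))
            ≡⟨ Σ-cong {n} (λ l → trans (x*yz≈y*xz _ _ _) (cong (_* _) (I-sym l i))) ⟩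
          Σ[ n ] (λ l → I i l * (c l * diagonalWeight l (zeroRow? l)))
            ≡⟨ Σ-I i (λ l → c l * diagonalWeight l (zeroRow? l)) ⟩
          c i * diagonalWeight i (zeroRow? i) ∎

        lincomb-constraints-edge : ∀ c → (∀ l → ZeroRow u l → c l ≡ 0ℝ) →
          ∀ s {a b} → edge s ≡ (a , b) → lincomb c constraints (s ↑ˡ n) ≡ (c a + c b) * A a b
        lincomb-constraints-edge c c-zeroRow s {a} {b} eₛ≡ab = begin
          Σ[ n ] (λ l → c l * constraints l (s ↑ˡ n))
            ≡⟨ Σ-cong {n} (λ l → edge-term l (zeroRow? l)) ⟩
          Σ[ n ] (λ l → c l * incidence l a b)
            ≡⟨ Σ-cong {n} (λ l → solve 4 (λ c x y z → c :* ((x :+ y) :* z) := (c :* x :+ c :* y) :* z)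
                                         refl (c l) (I l a) (I l b) (A a b)) ⟩
          Σ[ n ] (λ l → (c l * I l a + c l * I l b) * A a b)
            ≡⟨ *-distribʳ-Σ n (A a b) _ ⟨
          Σ[ n ] (λ l → c l * I l a + c l * I l b) * A a b
            ≡⟨ cong (_* A a b) (trans (Σ-distrib-+ n _ _) (cong₂ _+_ (Σ-I′ a c) (Σ-I′ b c))) ⟩
          (c a + c b) * A a b ∎
          where
          edge-term : ∀ l d → c l * constraint l d (s ↑ˡ n) ≡ c l * incidence l a b
          edge-term l (yes zero-row) = begin
            c l * constraint l (yes zero-row) (s ↑ˡ n)  ≡⟨ cong (c l *_) (lookup-++ˡ (λ (_ : Fin (e G)) → 0ℝ) (I l) s) ⟩
            c l * 0ℝ                                    ≡⟨ zeroʳ _ ⟩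
            0ℝ                                          ≡⟨ zeroˡ _ ⟨
            0ℝ * incidence l a b                        ≡⟨ cong (_* incidence l a b) (c-zeroRow l zero-row) ⟨
            c l * incidence l a b                       ∎
          edge-term l (no _) =
            cong (c l *_) (trans (lookup-++ˡ (uncurry (incidence l) ∘ edge) _ s) (cong (uncurry (incidence l)) eₛ≡ab))

        constraints-independentExcept : ∀ {i₀ r} → u r i₀ ≢ 0ℝ → WeaklyIndependentExcept constraints i₀
        constraints-independentExcept {i₀} {r} uᵣᵢ₀≢0 c c·φ≡0 cᵢ₀≡0 i = by-row (zeroRow? i)
          where
          c-zeroRow : ∀ l → ZeroRow u l → c l ≡ 0ℝ
          c-zeroRow l zero-row with zeroRow? l | lincomb-constraints-diagonal c l
          ... | yes _      | c·φ≡cₗ = trans (sym (*-identityʳ (c l))) (trans (sym c·φ≡cₗ) (c·φ≡0 (e G ↑ʳ l)))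
          ... | no nonzero | _      = contradiction zero-row nonzero

          c-antisymmetric : ∀ {a b} → a ≢ b → adj G a b ≡ true → c a + c b ≡ 0ℝ
          c-antisymmetric = edges-cover (λ a b → c a + c b ≡ 0ℝ) (trans (+-comm _ _))
            (λ s {a} {b} eₛ≡ab a≢b a~b → x*y≡0⇒x≡0 (proj₁ (A-graph a b a≢b) a~b)
              (trans (sym (lincomb-constraints-edge c c-zeroRow s eₛ≡ab)) (c·φ≡0 (s ↑ˡ n))))

          q : Vector n
          q l = c l * c l

          q-edgeConstant : ∀ {a b} → a ≢ b → adj G a b ≡ true → q a ≡ q b
          q-edgeConstant {a} {b} a≢b a~b = begin
            c a * c a
              ≡⟨ cong (λ x → x * x) (+-inverseʳ-unique (c b) (c a) (trans (+-comm _ _) (c-antisymmetric a≢b a~b))) ⟩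
            - c b * - c b    ≡⟨ solve 1 (λ x → :- x :* :- x := x :* x) refl (c b) ⟩
            c b * c b        ∎

          by-row : Dec (ZeroRow u i) → ¬ ¬ c i ≡ 0ℝ
          by-row (yes zero-row) = pure (c-zeroRow i zero-row)
          by-row (no nonzero-row) = nonzero-entry >>= λ (p , uₚᵢ≢0) cᵢ≢0 →
            *-≢0 (*-≢0 (*-≢0 (*-≢0 cᵢ≢0 cᵢ≢0) (*-≢0 cᵢ≢0 cᵢ≢0)) uₚᵢ≢0) uᵣᵢ₀≢0
              (commuting-diagonal-lemma q (edgeConstant⇒commutes q q-edgeConstant) (u-kernel p) (u-kernel r) i i₀
                                        (trans (cong (_* c i₀) cᵢ₀≡0) (zeroˡ _)))
            where
            nonzero-entry : ¬ ¬ Σ (Fin k) λ p → u p i ≢ 0ℝ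
            nonzero-entry no-entry = ¬¬-∀ (λ p uₚᵢ≢0 → no-entry (p , uₚᵢ≢0)) nonzero-row

  hasGraph⇒offEdge≡0 : ∀ {n} {G : Graph n} {A : Matrix n n} → HasGraph A G →
    ¬ ¬ (∀ a b → a ≢ b → adj G a b ≡ false → A a b ≡ 0ℝ)
  hasGraph⇒offEdge≡0 {G = G} {A} A-graph = ¬¬-∀ λ a → ¬¬-∀ λ b → by-cases a b <$> ¬¬-excluded-middle
    where
    by-cases : ∀ a b → Dec (A a b ≡ 0ℝ) → a ≢ b → adj G a b ≡ false → A a b ≡ 0ℝ
    by-cases a b (yes A≡0) _   _   = A≡0
    by-cases a b (no A≢0)  a≢b a≁b with () ← trans (sym a≁b) (proj₂ (A-graph a b a≢b) A≢0)

  kernel-dimension-count : ∀ {n} {G : Graph n} {A : Matrix n n} → Symmetric A → HasGraph A G → SAH A →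
    (∀ a b → a ≢ b → adj G a b ≡ false → A a b ≡ 0ℝ) →
    ∀ {k} (u : Fin k → Vector n) → (∀ p → InKernel A (u p)) → LinearlyIndependent u →
    (∀ l → Dec (ZeroRow u l)) → ∀ {i₀ r} → u r i₀ ≢ 0ℝ → ¬ ¬ (triangle k ℕ.≤ e G ℕ.+ 1)
  kernel-dimension-count {suc n′} {G} {A} A-sym A-graph A-sah A-offEdge {k} u u-kernel u-ind zeroRow? {i₀} uᵣᵢ₀≢0 =
    drop-vertex <$> weaklyIndependent⇒≤ (e G ℕ.+ suc n′) (symProductCoordinates ++ removeAt (constraints zeroRow?) i₀)
      (++-weaklyIndependent symProductCoordinates (removeAt (constraints zeroRow?) i₀)
        symProductCoordinates-independent
        (removeAt-weaklyIndependent (constraints zeroRow?) i₀ (constraints-independentExcept zeroRow? uᵣᵢ₀≢0))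
        (λ t l → constraint⊥symProductCoordinates t (punchIn i₀ l) (zeroRow? (punchIn i₀ l))))
    where
    open StrongArnold {G = G} {A} A-sym A-graph A-sah A-offEdge
    open KernelBasis u u-kernel u-ind

    drop-vertex : triangle k ℕ.+ n′ ℕ.≤ e G ℕ.+ suc n′ → triangle k ℕ.≤ e G ℕ.+ 1
    drop-vertex le = ℕ.+-cancelʳ-≤ n′ (triangle k) (e G ℕ.+ 1)
      (ℕ.≤-trans le (ℕ.≤-reflexive (sym (ℕ.+-assoc (e G) 1 n′))))

  kernel-dimension-bound : ∀ {n} {G : Graph n} {A : Matrix n n} → Symmetric A → HasGraph A G → SAH A →
    ∀ {k} (u : Fin k → Vector n) → (∀ p → InKernel A (u p)) → LinearlyIndependent u →
    ¬ ¬ (triangle k ℕ.≤ e G ℕ.+ 1)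
  kernel-dimension-bound A-sym A-graph A-sah {zero}  u u-kernel u-ind = pure ℕ.z≤n
  kernel-dimension-bound {G = G} {A} A-sym A-graph A-sah {suc k} u u-kernel u-ind = do
    A-offEdge ← hasGraph⇒offEdge≡0 {G = G} {A} A-graph
    zeroRow? ← ¬¬-∀ (λ l → ¬¬-excluded-middle)
    (i₀ , u₀ᵢ₀≢0) ← nonzero-entry
    kernel-dimension-count {G = G} {A} A-sym A-graph A-sah A-offEdge u u-kernel u-ind zeroRow? u₀ᵢ₀≢0
    where
    nonzero-entry : ¬ ¬ Σ (Fin _) λ i → u zero i ≢ 0ℝ
    nonzero-entry no-entry = ¬¬-∀ (λ i u₀ᵢ≢0 → no-entry (i , u₀ᵢ≢0)) λ u₀≡0 →
      0≢1 (sym (trans (sym (I-diag (zero {k}))) (u-ind (I zero) (λ j → trans (Σ-I zero (λ p → u p j)) (u₀≡0 j)) zero)))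

open import Data.Nat.Base using (_+_; _*_; _≤_; _/_)

triangle*2 : ∀ k → triangle k * 2 ≡ k * (k + 1)
triangle*2 zero    = ≡.refl
triangle*2 (suc k) = begin
  (suc k + triangle k) * 2      ≡⟨ ℕ.*-distribʳ-+ 2 (suc k) (triangle k) ⟩
  suc k * 2 + triangle k * 2    ≡⟨ cong (suc k * 2 +_) (triangle*2 k) ⟩
  suc k * 2 + k * (k + 1)       ≡⟨ ℕ-solve (k ∷ []) ⟩
  suc k * (suc k + 1)           ∎
  where open ≡.≡-Reasoning

triangle≡ : ∀ k → triangle k ≡ (k * (k + 1)) / 2
triangle≡ k = ≡.trans (≡.sym (m*n/n≡m (triangle k) 2)) (cong (_/ 2) (triangle*2 k))

corollary6p6 : (R : RealField) → let open Matrices R in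
    ∀ (n : ℕ) (G : Graph n) (A : Matrix n n) → Symmetric A → HasGraph A G → SAH A →
    ∀ (k : ℕ) → HasNullity A k → (k * (k + 1)) / 2 ≤ e G + 1
corollary6p6 R n G A A-sym A-graph A-sah k (u , u-kernel , u-ind , _) =
  ≡.subst (_≤ e G + 1) (triangle≡ k)
    (decidable-stable (triangle k ℕ.≤? e G + 1) (kernel-dimension-bound R {G = G} {A} A-sym A-graph A-sah u u-kernel u-ind))
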